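{- Let the subgraphs $\langle C_1 \rangle_{G_0}$ and $\langle C_2 \rangle_{G_0}$ of the graph $G_0$ be two $q$-cycles as well as $\langle C_1, C_2\rangle_{G_0}$ be an empty graph. Also, let $v_{1, i}$ and $v_{1, j}$ be two non-adjacent vertices of $G_0$. We add the edges $(v_{1, i}, v_{1, j}), (v_{1, i}, v_{2, i})$ and $(v_{1, i}, v_{2, j})$ with $G_0$. The new graph $G$ is non-isomorphic and $Q$-cospectral to its partial transpose.
   Context: Graphs have $n = 2q$ vertices partitioned into clusters $C_1 = \{v_{1,1}, \dots, v_{1,q}\}$ and $C_2 = \{v_{2,1}, \dots, v_{2,q}\}$. $\langle C_\mu \rangle_G$ is the subgraph induced by $C_\mu$, and $\langle C_1, C_2 \rangle_G$ is the spanning subgraph with edges $\{(u,v): u \in C_1, v \in C_2\}$. The $q$-cycles are $(v_{\mu,1}, v_{\mu,2}, \dots, v_{\mu,q})$ in label order. The partial transpose $G^\tau$ is obtained by removing every existing edge $(v_{1,i}, v_{2,j})$ with $i \neq j$ and adding the edge $(v_{1,j}, v_{2,i})$; all other edges are unchanged. The signless Laplacian is $Q(G) = D(G) + A(G)$ (degree matrix plus adjacency matrix), and two graphs are $Q$-cospectral if their signless Laplacian matrices have the same spectrum. -}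

module Defs where

open import Data.Nat using (ℕ; zero; suc; _+_)
import Data.Nat as ℕ
open import Data.Fin using (Fin; zero; suc; toℕ; splitAt; punchIn)
import Data.Fin as Fin
open import Data.Sum using (_⊎_; inj₁; inj₂)
open import Data.Sum.Properties using (≡-dec)
open import Data.Bool using (Bool; true; false; _∧_; _∨_; if_then_else_)
open import Data.Integer using (ℤ; +_; -_) renaming (_+_ to _+ℤ_; _-_ to _-ℤ_; _*_ to _*ℤ_)
open import Data.Product using (Σ; _×_)
open import Function.Bundles using (_↔_; Inverse)
open import Relation.Nullary using (does)
open import Relation.Binary.PropositionalEquality using (_≡_)

-- Vertices of a graph on n = 2q vertices: inj₁ i is v_{1,i}, inj₂ i is v_{2,i}
-- (i ranges over Fin q, i.e. labels 0..q-1 instead of 1..q).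
Vertex : ℕ → Set
Vertex q = Fin q ⊎ Fin q

Graph : ℕ → Set
Graph q = Vertex q → Vertex q → Bool

eqV : {q : ℕ} → Vertex q → Vertex q → Bool
eqV x y = does (≡-dec Fin._≟_ Fin._≟_ x y)

-- b is the successor of a in the cyclic label order 0,1,...,q-1,0
succAdj : {q : ℕ} → Fin q → Fin q → Bool
succAdj {q} a b = does (toℕ b ℕ.≟ suc (toℕ a))
                ∨ (does (suc (toℕ a) ℕ.≟ q) ∧ does (toℕ b ℕ.≟ 0))

cycAdj : {q : ℕ} → Fin q → Fin q → Bool
cycAdj a b = succAdj a b ∨ succAdj b a

G₀ : (q : ℕ) → Graph q
G₀ q (inj₁ a) (inj₁ b) = cycAdj a b
G₀ q (inj₂ a) (inj₂ b) = cycAdj a b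
G₀ q (inj₁ a) (inj₂ b) = false
G₀ q (inj₂ a) (inj₁ b) = false

addEdge : {q : ℕ} → Vertex q → Vertex q → Graph q → Graph q
addEdge u v G x y = G x y ∨ (eqV x u ∧ eqV y v) ∨ (eqV x v ∧ eqV y u)

Gnew : (q : ℕ) → Fin q → Fin q → Graph q
Gnew q i j = addEdge (inj₁ i) (inj₂ j)
               (addEdge (inj₁ i) (inj₂ i)
                 (addEdge (inj₁ i) (inj₁ j) (G₀ q)))

-- partial transpose: cross edge (v_{1,a},v_{2,b}) with a ≠ b is present in G^τ
-- iff (v_{1,b},v_{2,a}) is present in G; all other adjacencies unchanged.
crossτ : {q : ℕ} → Graph q → Fin q → Fin q → Bool
crossτ G a b = if does (a Fin.≟ b) then G (inj₁ a) (inj₂ b) else G (inj₁ b) (inj₂ a)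

partialTranspose : {q : ℕ} → Graph q → Graph q
partialTranspose G (inj₁ a) (inj₂ b) = crossτ G a b
partialTranspose G (inj₂ b) (inj₁ a) = crossτ G a b
partialTranspose G (inj₁ a) (inj₁ b) = G (inj₁ a) (inj₁ b)
partialTranspose G (inj₂ a) (inj₂ b) = G (inj₂ a) (inj₂ b)

Isomorphic : (q : ℕ) → Graph q → Graph q → Set
Isomorphic q G H = Σ (Vertex q ↔ Vertex q) λ f →
  ∀ x y → G x y ≡ H (Inverse.to f x) (Inverse.to f y)

Matrix : ℕ → Set
Matrix n = Fin n → Fin n → ℤ

sumℕ : (n : ℕ) → (Fin n → ℕ) → ℕ
sumℕ zero f = 0
sumℕ (suc n) f = f zero + sumℕ n (λ k → f (suc k))

sumℤ : (n : ℕ) → (Fin n → ℤ) → ℤ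
sumℤ zero f = + 0
sumℤ (suc n) f = f zero +ℤ sumℤ n (λ k → f (suc k))

sign : ℕ → ℤ
sign zero = + 1
sign (suc k) = - sign k

det : (n : ℕ) → Matrix n → ℤ
det zero M = + 1
det (suc n) M = sumℤ (suc n) λ j →
  sign (toℕ j) *ℤ (M zero j *ℤ det n (λ a b → M (suc a) (punchIn j b)))

-- index k ∈ Fin (q + q): k < q ↦ v_{1,k}, k = q + i ↦ v_{2,i}
vtx : {q : ℕ} → Fin (q + q) → Vertex q
vtx {q} k = splitAt q k

δ : {n : ℕ} → Fin n → Fin n → ℤ → ℤ
δ a b t = if does (a Fin.≟ b) then t else + 0

degree : {q : ℕ} → Graph q → Vertex q → ℕ
degree {q} G x = sumℕ (q + q) λ k → if G x (vtx k) then 1 else 0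

Dmat : {q : ℕ} → Graph q → Matrix (q + q)
Dmat G a b = δ a b (+ degree G (vtx a))

Amat : {q : ℕ} → Graph q → Matrix (q + q)
Amat G a b = if G (vtx a) (vtx b) then + 1 else + 0

Qmat : {q : ℕ} → Graph q → Matrix (q + q)
Qmat G a b = Dmat G a b +ℤ Amat G a b

charPolyQ : {q : ℕ} → Graph q → ℤ → ℤ
charPolyQ {q} G t = det (q + q) λ a b → δ a b t -ℤ Qmat G a b

-- Q-cospectral: Q(G) and Q(H) have the same characteristic polynomial
-- (equivalently the same spectrum with multiplicities); two integer
-- polynomials are equal iff they agree at every integer.
QCospectral : (q : ℕ) → Graph q → Graph q → Set
QCospectral q G H = ∀ t → charPolyQ G t ≡ charPolyQ H t

-- G₀ is two disjoint q-cycles (q ≥ 3); G adds the edges v₁v₂, v₁v₃, v₁v₄ with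
-- v₁ = v_{1,i}, v₂ = v_{1,j}, v₃ = v_{2,i}, v₄ = v_{2,j} (v₁, v₂ non-adjacent); its
-- partial transpose Gᵗ trades the cross edge v₁v₄ for v₂v₃.
--
-- Non-isomorphism: v₁ has degree 5 in G, while every degree of Gᵗ is even.
-- Q-cospectrality: let Σ exchange the clusters, let P reflect both cycles so
-- that i ↔ j, and W = I + P + Σ - PΣ.  tI - Q(H) is a part invariant under P
-- and Σ (which X ↦ W X Wᵀ multiplies by 4) minus the signless Laplacians
-- (X u + X w)(X u + X w)ᵀ of the added edges uw; conjugation by W fixes those
-- of v₁v₂, v₁v₃ and swaps those of v₁v₄, v₂v₃.  So W (tI - Q(G)) Wᵀ = 4 (tI - Q(Gᵗ))
-- and conversely, which forces equal determinants.
module Submission where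

open import Defs
open import Data.Nat using (ℕ; _≤_)
open import Data.Fin using (Fin)
open import Data.Sum using (inj₁; inj₂)
open import Data.Bool using (false)
open import Data.Product using (_×_)
open import Relation.Nullary using (¬_)
open import Relation.Binary.PropositionalEquality using (_≡_; _≢_)
open import Data.Nat using (suc; s≤s; z≤n)
open import Data.Product using (_,_)
open import Relation.Binary.PropositionalEquality using (refl)

-- Finite sums of integers over Fin n.
module FiniteSums where

  open import Defs using (sumℕ; sumℤ)
  open import Data.Nat as ℕ using (ℕ; zero; suc)
  open import Data.Fin as Fin using (Fin; zero; suc; punchIn; punchOut)
  open import Data.Fin.Properties
    using (punchInᵢ≢i; punchIn-punchOut; punchOut-punchIn; punchOut-cong)
  open import Data.Integer using (ℤ; +_; -_; _+_; _*_; _-_; 0ℤ; 1ℤ)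
  open import Data.Integer.Properties
  open import Data.Integer.Solver using (module +-*-Solver)
  open +-*-Solver
  open import Data.Bool using (if_then_else_)
  open import Function using (_∘_)
  open import Relation.Nullary using (Dec; yes; no; does; ¬_; contradiction)
  open import Relation.Binary.PropositionalEquality
  open ≡-Reasoning

  sum-cong : ∀ n {f g : Fin n → ℤ} → (∀ k → f k ≡ g k) → sumℤ n f ≡ sumℤ n g
  sum-cong zero e = refl
  sum-cong (suc n) e = cong₂ _+_ (e zero) (sum-cong n (e ∘ suc))

  sum-+ : ∀ n (f g : Fin n → ℤ) → sumℤ n (λ k → f k + g k) ≡ sumℤ n f + sumℤ n g
  sum-+ zero f g = refl
  sum-+ (suc n) f g rewrite sum-+ n (f ∘ suc) (g ∘ suc) =
    solve 4 (λ a b c d → (a :+ b) :+ (c :+ d) := (a :+ c) :+ (b :+ d)) refl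
      (f zero) (g zero) (sumℤ n (f ∘ suc)) (sumℤ n (g ∘ suc))

  sum-* : ∀ n (c : ℤ) (f : Fin n → ℤ) → sumℤ n (λ k → c * f k) ≡ c * sumℤ n f
  sum-* zero c f = sym (*-zeroʳ c)
  sum-* (suc n) c f rewrite sum-* n c (f ∘ suc) = sym (*-distribˡ-+ c (f zero) _)

  sum-neg : ∀ n (f : Fin n → ℤ) → sumℤ n (λ k → - f k) ≡ - sumℤ n f
  sum-neg zero f = refl
  sum-neg (suc n) f rewrite sum-neg n (f ∘ suc) = sym (neg-distrib-+ (f zero) _)

  sum-zero : ∀ n (f : Fin n → ℤ) → (∀ k → f k ≡ 0ℤ) → sumℤ n f ≡ 0ℤ
  sum-zero zero f e = refl
  sum-zero (suc n) f e = cong₂ _+_ (e zero) (sum-zero n (f ∘ suc) (e ∘ suc))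

  sum-swap : ∀ m n (F : Fin m → Fin n → ℤ) →
    sumℤ m (λ a → sumℤ n (F a)) ≡ sumℤ n (λ b → sumℤ m (λ a → F a b))
  sum-swap zero n F = sym (sum-zero n _ (λ _ → refl))
  sum-swap (suc m) n F = begin
    sumℤ n (F zero) + sumℤ m (λ a → sumℤ n (F (suc a)))
      ≡⟨ cong (_+_ (sumℤ n (F zero))) (sum-swap m n (F ∘ suc)) ⟩
    sumℤ n (F zero) + sumℤ n (λ b → sumℤ m (λ a → F (suc a) b))
      ≡⟨ sum-+ n (F zero) _ ⟨
    sumℤ n (λ b → F zero b + sumℤ m (λ a → F (suc a) b)) ∎

  sum-remove : ∀ n (p : Fin (suc n)) (h : Fin (suc n) → ℤ) →
    sumℤ (suc n) h ≡ h p + sumℤ n (h ∘ punchIn p)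
  sum-remove n zero h = refl
  sum-remove (suc n) (suc p) h rewrite sum-remove n p (h ∘ suc) =
    solve 3 (λ a b c → a :+ (b :+ c) := b :+ (a :+ c)) refl (h zero) (h (suc p)) _

  sumℕ-to-ℤ : ∀ n (f : Fin n → ℕ) → + sumℕ n f ≡ sumℤ n (λ k → + f k)
  sumℕ-to-ℤ zero f = refl
  sumℕ-to-ℤ (suc n) f = cong (_+_ (+ f zero)) (sumℕ-to-ℤ n (f ∘ suc))

  sum-permute : ∀ n (π ψ : Fin n → Fin n) → (∀ k → ψ (π k) ≡ k) → (∀ k → π (ψ k) ≡ k) →
    ∀ (h : Fin n → ℤ) → sumℤ n (h ∘ π) ≡ sumℤ n h
  sum-permute zero π ψ ψπ πψ h = refl
  sum-permute (suc n) π ψ ψπ πψ h = begin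
    h p + sumℤ n (h ∘ π ∘ suc)
      ≡⟨ cong (_+_ (h p)) (sum-cong n (λ k → cong h (sym (punchIn-punchOut (p≢ k))))) ⟩
    h p + sumℤ n (h ∘ punchIn p ∘ π′)
      ≡⟨ cong (_+_ (h p)) (sum-permute n π′ ψ′ ψ′π′ π′ψ′ (h ∘ punchIn p)) ⟩
    h p + sumℤ n (h ∘ punchIn p)
      ≡⟨ sum-remove n p h ⟨
    sumℤ (suc n) h ∎
    where
    p = π zero
    p≢ : ∀ k → p ≢ π (suc k)
    p≢ k e with trans (sym (ψπ zero)) (trans (cong ψ e) (ψπ (suc k)))
    ... | ()
    -- π restricted to the indices other than 0, landing in those other than π 0,
    -- and its inverse
    π′ : Fin n → Fin n
    π′ k = punchOut (p≢ k)
    0≢ : ∀ k → zero ≢ ψ (punchIn p k)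
    0≢ k e = punchInᵢ≢i p k (sym (trans (cong π e) (πψ (punchIn p k))))
    ψ′ : Fin n → Fin n
    ψ′ k = punchOut (0≢ k)
    ψ′π′ : ∀ k → ψ′ (π′ k) ≡ k
    ψ′π′ k = punchOut-cong zero {i≢k = λ ()} (trans (cong ψ (punchIn-punchOut (p≢ k))) (ψπ (suc k)))
    π′ψ′ : ∀ k → π′ (ψ′ k) ≡ k
    π′ψ′ k = trans (punchOut-cong p {i≢k = punchInᵢ≢i p k ∘ sym}
                      (trans (cong π (punchIn-punchOut (0≢ k))) (πψ (punchIn p k))))
                   (punchOut-punchIn p)

  ind : ∀ {p} {P : Set p} → Dec P → ℤ
  ind d = if does d then 1ℤ else 0ℤ

  ind-yes : ∀ {p} {P : Set p} (d : Dec P) → P → ind d ≡ 1ℤ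
  ind-yes (yes _) _ = refl
  ind-yes (no ¬p) p = contradiction p ¬p

  ind-no : ∀ {p} {P : Set p} (d : Dec P) → ¬ P → ind d ≡ 0ℤ
  ind-no (yes p) ¬p = contradiction p ¬p
  ind-no (no _) _ = refl

  sum-delta : ∀ n (p : Fin n) (f : Fin n → ℤ) → sumℤ n (λ b → ind (b Fin.≟ p) * f b) ≡ f p
  sum-delta (suc n) p f = begin
    sumℤ (suc n) (λ b → ind (b Fin.≟ p) * f b)
      ≡⟨ sum-remove n p (λ b → ind (b Fin.≟ p) * f b) ⟩
    ind (p Fin.≟ p) * f p + sumℤ n (λ k → ind (punchIn p k Fin.≟ p) * f (punchIn p k))
      ≡⟨ cong₂ _+_ (cong (_* f p) (ind-yes (p Fin.≟ p) refl))
                   (sum-zero n _ (λ k → cong (_* f (punchIn p k)) (ind-no (punchIn p k Fin.≟ p) (punchInᵢ≢i p k)))) ⟩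
    1ℤ * f p + 0ℤ
      ≡⟨ solve 1 (λ x → con 1ℤ :* x :+ con 0ℤ := x) refl (f p) ⟩
    f p ∎

  sum-indicator : ∀ n (p : Fin n) → sumℤ n (λ b → ind (b Fin.≟ p)) ≡ 1ℤ
  sum-indicator n p = trans (sum-cong n (λ b → sym (*-identityʳ (ind (b Fin.≟ p))))) (sum-delta n p (λ _ → 1ℤ))

  sum-offDiagonal : ∀ n (F : Fin (suc n) → Fin (suc n) → ℤ) →
    sumℤ (suc n) (λ j → sumℤ n (λ k → F j (punchIn j k))) ≡
    sumℤ (suc n) (λ l → sumℤ n (λ m → F (punchIn l m) l))
  sum-offDiagonal n F = begin
    sumℤ (suc n) (λ j → sumℤ n (λ k → F j (punchIn j k)))
      ≡⟨ sum-cong (suc n) (λ j → sum-without (F j) j) ⟩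
    sumℤ (suc n) (λ j → sumℤ (suc n) (F j) - F j j)
      ≡⟨ sum-+ (suc n) (λ j → sumℤ (suc n) (F j)) (λ j → - F j j) ⟩
    sumℤ (suc n) (λ j → sumℤ (suc n) (F j)) + sumℤ (suc n) (λ j → - F j j)
      ≡⟨ cong (_+ sumℤ (suc n) (λ j → - F j j)) (sum-swap (suc n) (suc n) F) ⟩
    sumℤ (suc n) (λ l → sumℤ (suc n) (λ j → F j l)) + sumℤ (suc n) (λ j → - F j j)
      ≡⟨ sum-+ (suc n) (λ l → sumℤ (suc n) (λ j → F j l)) (λ j → - F j j) ⟨
    sumℤ (suc n) (λ l → sumℤ (suc n) (λ j → F j l) - F l l)
      ≡⟨ sum-cong (suc n) (λ l → sum-without (λ j → F j l) l) ⟨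
    sumℤ (suc n) (λ l → sumℤ n (λ m → F (punchIn l m) l)) ∎
    where
    sum-without : ∀ (h : Fin (suc n) → ℤ) p → sumℤ n (h ∘ punchIn p) ≡ sumℤ (suc n) h - h p
    sum-without h p rewrite sum-remove n p h =
      solve 2 (λ a b → b := (a :+ b) :- a) refl (h p) (sumℤ n (h ∘ punchIn p))

-- Determinants (defined in Defs by expansion along the first row): Laplace
-- expansion along any row, alternation, multiplicativity and the sandwich
-- argument that turns conjugation identities into equal determinants.
module Determinants where

  open import Defs using (Matrix; sumℤ; sign; det)
  open FiniteSums
  open import Data.Nat as ℕ using (ℕ; zero; suc)
  import Data.Nat.Properties as ℕP
  open import Data.Fin as Fin using (Fin; zero; suc; toℕ; punchIn; punchOut; fromℕ<)
  open import Data.Fin.Properties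
    using (punchOut-punchIn; punchInᵢ≢i; punchOut-cong; punchOut-injective; pigeonhole; any?;
           toℕ<n; toℕ-injective; toℕ-fromℕ<)
  open import Data.Integer using (ℤ; +_; -_; _+_; _*_; _-_; 0ℤ; 1ℤ; -[1+_])
  open import Data.Integer.Properties
  open import Data.Integer.Solver using (module +-*-Solver)
  open +-*-Solver
  open import Data.Bool using (if_then_else_)
  open import Function using (_∘_; id)
  open import Data.Product using (Σ; _,_; proj₁; proj₂)
  open import Data.Sum using (_⊎_; inj₁; inj₂)
  open import Relation.Nullary using (Dec; yes; no; does; ¬_; contradiction)
  open import Relation.Binary.PropositionalEquality
  open ≡-Reasoning

  sign-+ : ∀ m n → sign (m ℕ.+ n) ≡ sign m * sign n
  sign-+ zero n = sym (*-identityˡ (sign n))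
  sign-+ (suc m) n rewrite sign-+ m n = neg-distribˡ-* (sign m) (sign n)

  sign-suc-suc : ∀ a b → sign (suc a ℕ.+ suc b) ≡ sign (a ℕ.+ b)
  sign-suc-suc a b rewrite ℕP.+-suc a b = neg-involutive (sign (a ℕ.+ b))

  minor : ∀ {n} → Fin (suc n) → Fin (suc n) → Matrix (suc n) → Matrix n
  minor r k M a b = M (punchIn r a) (punchIn k b)

  det-cong : ∀ n {M N : Matrix n} → (∀ a b → M a b ≡ N a b) → det n M ≡ det n N
  det-cong zero e = refl
  det-cong (suc n) e = sum-cong (suc n) (λ j →
    cong₂ (λ x y → sign (toℕ j) * (x * y)) (e zero j) (det-cong n (λ a b → e (suc a) (punchIn j b))))

  -- Deleting column l and then the m-th remaining column leaves the same
  -- columns as deleting column punchIn l m first and then the column that l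
  -- has become ...
  punchIn-exchange : ∀ {n} (l : Fin (suc (suc n))) (m : Fin (suc n)) (ne : punchIn l m ≢ l) (b : Fin n) →
    punchIn l (punchIn m b) ≡ punchIn (punchIn l m) (punchIn (punchOut ne) b)
  punchIn-exchange zero m ne b = refl
  punchIn-exchange (suc l) zero ne b = refl
  punchIn-exchange (suc l) (suc m) ne zero = refl
  punchIn-exchange (suc l) (suc m) ne (suc b) = cong suc (punchIn-exchange l m (ne ∘ cong suc) b)

  -- ... and the corresponding positional signs differ by exactly one factor -1.
  punchIn-exchange-sign : ∀ {n} (l : Fin (suc n)) (m : Fin n) (ne : punchIn l m ≢ l) →
    sign (toℕ (punchIn l m) ℕ.+ toℕ (punchOut ne)) ≡ - sign (toℕ l ℕ.+ toℕ m)
  punchIn-exchange-sign {suc n} zero m ne rewrite ℕP.+-identityʳ (toℕ m) = refl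
  punchIn-exchange-sign (suc l) zero ne rewrite ℕP.+-identityʳ (toℕ l) = sym (neg-involutive _)
  punchIn-exchange-sign (suc l) (suc m) ne = begin
    sign (suc (toℕ (punchIn l m)) ℕ.+ suc (toℕ (punchOut (ne ∘ cong suc))))
      ≡⟨ sign-suc-suc (toℕ (punchIn l m)) (toℕ (punchOut (ne ∘ cong suc))) ⟩
    sign (toℕ (punchIn l m) ℕ.+ toℕ (punchOut (ne ∘ cong suc)))
      ≡⟨ punchIn-exchange-sign l m (ne ∘ cong suc) ⟩
    - sign (toℕ l ℕ.+ toℕ m)
      ≡⟨ cong -_ (sign-suc-suc (toℕ l) (toℕ m)) ⟨
    - sign (suc (toℕ l) ℕ.+ suc (toℕ m)) ∎

  laplace-sign : ∀ {n} (r : ℕ) (l : Fin (suc n)) (m : Fin n) (ne : punchIn l m ≢ l) →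
    sign (toℕ (punchIn l m)) * sign (r ℕ.+ toℕ (punchOut ne)) ≡ sign (suc r ℕ.+ toℕ l) * sign (toℕ m)
  laplace-sign r l m ne = begin
    sign (toℕ (punchIn l m)) * sign (r ℕ.+ toℕ (punchOut ne))
      ≡⟨ cong (sign (toℕ (punchIn l m)) *_) (sign-+ r (toℕ (punchOut ne))) ⟩
    sign (toℕ (punchIn l m)) * (sign r * sign (toℕ (punchOut ne)))
      ≡⟨ solve 3 (λ a b c → a :* (b :* c) := b :* (a :* c)) refl (sign (toℕ (punchIn l m))) (sign r) _ ⟩
    sign r * (sign (toℕ (punchIn l m)) * sign (toℕ (punchOut ne)))
      ≡⟨ cong (sign r *_) (sign-+ (toℕ (punchIn l m)) (toℕ (punchOut ne))) ⟨
    sign r * sign (toℕ (punchIn l m) ℕ.+ toℕ (punchOut ne))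
      ≡⟨ cong (sign r *_) (trans (punchIn-exchange-sign l m ne) (cong -_ (sign-+ (toℕ l) (toℕ m)))) ⟩
    sign r * (- (sign (toℕ l) * sign (toℕ m)))
      ≡⟨ solve 3 (λ a b c → a :* (:- (b :* c)) := (:- (a :* b)) :* c) refl (sign r) (sign (toℕ l)) (sign (toℕ m)) ⟩
    (- (sign r * sign (toℕ l))) * sign (toℕ m)
      ≡⟨ cong (λ x → (- x) * sign (toℕ m)) (sign-+ r (toℕ l)) ⟨
    sign (suc r ℕ.+ toℕ l) * sign (toℕ m) ∎

  private
    pull-constants : ∀ n (c d : ℤ) (g : Fin n → ℤ) → c * (d * sumℤ n g) ≡ sumℤ n (λ k → c * (d * g k))
    pull-constants n c d g = sym (trans (sum-* n c (λ k → d * g k)) (cong (c *_) (sum-* n d g)))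

  -- Row r + 1 is expanded inside
  -- each minor of the first-row expansion; the resulting double sum over pairs
  -- of distinct columns is re-enumerated with sum-offDiagonal.
  laplace : ∀ n (r : Fin (suc n)) (M : Matrix (suc n)) →
    det (suc n) M ≡ sumℤ (suc n) (λ k → sign (toℕ r ℕ.+ toℕ k) * (M r k * det n (minor r k M)))
  laplace n zero M = refl
  laplace (suc n) (suc r) M = begin
    det (suc (suc n)) M
      ≡⟨ sum-cong (suc (suc n)) (λ j → cong (λ x → sign (toℕ j) * (M zero j * x)) (laplace n r (minor zero j M))) ⟩
    sumℤ (suc (suc n)) (λ j → sign (toℕ j) * (M zero j * sumℤ (suc n) (λ k → sign (toℕ r ℕ.+ toℕ k) *
        (M (suc r) (punchIn j k) * D j k))))
      ≡⟨ sum-cong (suc (suc n)) (λ j → trans (pull-constants (suc n) (sign (toℕ j)) (M zero j)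
                                                (λ k → sign (toℕ r ℕ.+ toℕ k) * (M (suc r) (punchIn j k) * D j k)))
                                              (sum-cong (suc n) (λ k → sym (F-first j k)))) ⟩
    sumℤ (suc (suc n)) (λ j → sumℤ (suc n) (λ k → F j (punchIn j k)))
      ≡⟨ sum-offDiagonal (suc n) F ⟩
    sumℤ (suc (suc n)) (λ l → sumℤ (suc n) (λ m → F (punchIn l m) l))
      ≡⟨ sum-cong (suc (suc n)) (λ l → trans (sum-cong (suc n) (F-second l))
                                              (sym (pull-constants (suc n) (sign (suc (toℕ r) ℕ.+ toℕ l)) (M (suc r) l)
                                                (λ m → sign (toℕ m) * (M zero (punchIn l m) * det n (λ a b → M (suc (punchIn r a)) (punchIn l (punchIn m b)))))))) ⟩
    sumℤ (suc (suc n)) (λ l → sign (toℕ (suc r) ℕ.+ toℕ l) * (M (suc r) l * det (suc n) (minor (suc r) l M))) ∎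
    where
    -- the minor deleting rows 0, r + 1 and columns j, punchIn j k
    D : Fin (suc (suc n)) → Fin (suc n) → ℤ
    D j k = det n (λ a b → M (suc (punchIn r a)) (punchIn j (punchIn k b)))
    -- the term of the double expansion using column j in row 0 and column l in row r + 1
    F′ : ∀ j l → Dec (j ≡ l) → ℤ
    F′ j l (yes _) = 0ℤ
    F′ j l (no j≢l) = sign (toℕ j) * (M zero j * (sign (toℕ r ℕ.+ toℕ (punchOut j≢l)) *
                        (M (suc r) l * D j (punchOut j≢l))))
    F : Fin (suc (suc n)) → Fin (suc (suc n)) → ℤ
    F j l = F′ j l (j Fin.≟ l)
    F-first : ∀ j k → F j (punchIn j k) ≡ sign (toℕ j) * (M zero j * (sign (toℕ r ℕ.+ toℕ k) *
                        (M (suc r) (punchIn j k) * D j k)))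
    F-first j k with j Fin.≟ punchIn j k
    ... | yes eq = contradiction (sym eq) (punchInᵢ≢i j k)
    ... | no ne = cong (λ x → sign (toℕ j) * (M zero j * (sign (toℕ r ℕ.+ toℕ x) * (M (suc r) (punchIn j k) * D j x))))
                       (trans (punchOut-cong j refl) (punchOut-punchIn j))
    F-second : ∀ l m → F (punchIn l m) l ≡ sign (suc (toℕ r) ℕ.+ toℕ l) * (M (suc r) l * (sign (toℕ m) *
                        (M zero (punchIn l m) * det n (λ a b → M (suc (punchIn r a)) (punchIn l (punchIn m b))))))
    F-second l m with punchIn l m Fin.≟ l
    ... | yes eq = contradiction eq (punchInᵢ≢i l m)
    ... | no ne = begin
      s₁ * (a₀ * (s₂ * (a₁ * D (punchIn l m) (punchOut ne))))
        ≡⟨ cong (λ x → s₁ * (a₀ * (s₂ * (a₁ * x)))) (det-cong n (λ a b → cong (M (suc (punchIn r a))) (sym (punchIn-exchange l m ne b)))) ⟩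
      s₁ * (a₀ * (s₂ * (a₁ * D′)))
        ≡⟨ solve 5 (λ a b c d e → a :* (b :* (c :* (d :* e))) := (a :* c) :* (d :* (b :* e))) refl s₁ a₀ s₂ a₁ D′ ⟩
      (s₁ * s₂) * (a₁ * (a₀ * D′))
        ≡⟨ cong (_* (a₁ * (a₀ * D′))) (laplace-sign (toℕ r) l m ne) ⟩
      (sign (suc (toℕ r) ℕ.+ toℕ l) * sign (toℕ m)) * (a₁ * (a₀ * D′))
        ≡⟨ solve 5 (λ a b c d e → (a :* b) :* (c :* (d :* e)) := a :* (c :* (b :* (d :* e)))) refl
             (sign (suc (toℕ r) ℕ.+ toℕ l)) (sign (toℕ m)) a₁ a₀ D′ ⟩
      sign (suc (toℕ r) ℕ.+ toℕ l) * (a₁ * (sign (toℕ m) * (a₀ * D′))) ∎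
      where
      s₁ = sign (toℕ (punchIn l m))
      s₂ = sign (toℕ r ℕ.+ toℕ (punchOut ne))
      a₀ = M zero (punchIn l m)
      a₁ = M (suc r) l
      D′ = det n (λ a b → M (suc (punchIn r a)) (punchIn l (punchIn m b)))

  ≡-neg⇒≡0 : ∀ x → x ≡ - x → x ≡ 0ℤ
  ≡-neg⇒≡0 (+ zero) _ = refl
  ≡-neg⇒≡0 (+ suc n) ()
  ≡-neg⇒≡0 -[1+ n ] ()

  -- If neither row is the
  -- first one, expand along the first row; if the first two rows coincide, the
  -- expansions along rows 0 and 1 are negatives of each other; otherwise expand
  -- along row 1.
  mutual
    det-equalRows : ∀ n (M : Matrix (suc n)) (r s : Fin (suc n)) → r ≢ s →
      (∀ b → M r b ≡ M s b) → det (suc n) M ≡ 0ℤ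
    det-equalRows zero M zero zero r≢s _ = contradiction refl r≢s
    det-equalRows (suc n) M zero zero r≢s _ = contradiction refl r≢s
    det-equalRows (suc n) M zero (suc s) _ rows = det-equalRows-first n M s rows
    det-equalRows (suc n) M (suc r) zero _ rows = det-equalRows-first n M r (sym ∘ rows)
    det-equalRows (suc n) M (suc r) (suc s) r≢s rows = sum-zero (suc (suc n)) _ (λ j →
      trans (cong (λ x → sign (toℕ j) * (M zero j * x))
                  (det-equalRows n (minor zero j M) r s (r≢s ∘ cong suc) (rows ∘ punchIn j)))
            (trans (cong (sign (toℕ j) *_) (*-zeroʳ (M zero j))) (*-zeroʳ (sign (toℕ j)))))

    det-equalRows-first : ∀ n (M : Matrix (suc (suc n))) (s : Fin (suc n)) →
      (∀ b → M zero b ≡ M (suc s) b) → det (suc (suc n)) M ≡ 0ℤ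
    det-equalRows-first n M (suc s) rows = trans (laplace (suc n) (suc zero) M) (sum-zero (suc (suc n)) _ (λ k →
      trans (cong (λ x → sign (suc (toℕ k)) * (M (suc zero) k * x))
                  (det-equalRows n (minor (suc zero) k M) zero (suc s) (λ ()) (rows ∘ punchIn k)))
            (trans (cong (sign (suc (toℕ k)) *_) (*-zeroʳ (M (suc zero) k))) (*-zeroʳ (sign (suc (toℕ k)))))))
    det-equalRows-first n M zero rows = ≡-neg⇒≡0 (det (suc (suc n)) M) (begin
      det (suc (suc n)) M
        ≡⟨ laplace (suc n) (suc zero) M ⟩
      sumℤ (suc (suc n)) (λ k → sign (suc (toℕ k)) * (M (suc zero) k * det (suc n) (minor (suc zero) k M)))
        ≡⟨ sum-cong (suc (suc n)) (λ k → trans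
             (cong₂ (λ x y → sign (suc (toℕ k)) * (x * y)) (sym (rows k))
                    (det-cong (suc n) {minor (suc zero) k M} {minor zero k M}
                      (λ { zero b → rows (punchIn k b) ; (suc a) b → refl })))
             (sym (neg-distribˡ-* (sign (toℕ k)) (M zero k * det (suc n) (minor zero k M))))) ⟩
      sumℤ (suc (suc n)) (λ k → - (sign (toℕ k) * (M zero k * det (suc n) (minor zero k M))))
        ≡⟨ sum-neg (suc (suc n)) (λ k → sign (toℕ k) * (M zero k * det (suc n) (minor zero k M))) ⟩
      - det (suc (suc n)) M ∎)

  setRow : ∀ {n} → Fin n → (Fin n → ℤ) → Matrix n → Matrix n
  setRow r v M a b = if does (a Fin.≟ r) then v b else M a b

  setRow-at : ∀ {n} (r : Fin n) v M b → setRow r v M r b ≡ v b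
  setRow-at r v M b with r Fin.≟ r
  ... | yes _ = refl
  ... | no r≢r = contradiction refl r≢r

  setRow-off : ∀ {n} (r a : Fin n) v M b → a ≢ r → setRow r v M a b ≡ M a b
  setRow-off r a v M b a≢r with a Fin.≟ r
  ... | yes a≡r = contradiction a≡r a≢r
  ... | no _ = refl

  cofactor : ∀ {n} → Fin (suc n) → Matrix (suc n) → Fin (suc n) → ℤ
  cofactor {n} r M k = sign (toℕ r ℕ.+ toℕ k) * det n (minor r k M)

  det-setRow : ∀ n (r : Fin (suc n)) v M → det (suc n) (setRow r v M) ≡ sumℤ (suc n) (λ k → v k * cofactor r M k)
  det-setRow n r v M = trans (laplace n r (setRow r v M)) (sum-cong (suc n) (λ k →
    trans (cong₂ (λ x y → sign (toℕ r ℕ.+ toℕ k) * (x * y)) (setRow-at r v M k)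
            (det-cong n (λ a b → setRow-off r (punchIn r a) v M (punchIn k b) (punchInᵢ≢i r a))))
          (solve 3 (λ a b c → a :* (b :* c) := b :* (a :* c)) refl (sign (toℕ r ℕ.+ toℕ k)) (v k) (det n (minor r k M)))))

  det-setRow-+ : ∀ n (r : Fin (suc n)) u w M →
    det (suc n) (setRow r (λ b → u b + w b) M) ≡ det (suc n) (setRow r u M) + det (suc n) (setRow r w M)
  det-setRow-+ n r u w M rewrite det-setRow n r (λ b → u b + w b) M | det-setRow n r u M | det-setRow n r w M =
    trans (sum-cong (suc n) (λ k → *-distribʳ-+ (cofactor r M k) (u k) (w k)))
          (sum-+ (suc n) (λ k → u k * cofactor r M k) (λ k → w k * cofactor r M k))

  det-setRow-sum : ∀ n (r : Fin (suc n)) (g : Fin (suc n) → ℤ) (V : Fin (suc n) → Fin (suc n) → ℤ) M →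
    det (suc n) (setRow r (λ c → sumℤ (suc n) (λ k → g k * V k c)) M) ≡ sumℤ (suc n) (λ k → g k * det (suc n) (setRow r (V k) M))
  det-setRow-sum n r g V M = begin
    det (suc n) (setRow r (λ c → sumℤ (suc n) (λ k → g k * V k c)) M)
      ≡⟨ det-setRow n r (λ c → sumℤ (suc n) (λ k → g k * V k c)) M ⟩
    sumℤ (suc n) (λ c → sumℤ (suc n) (λ k → g k * V k c) * cofactor r M c)
      ≡⟨ sum-cong (suc n) (λ c → trans (*-comm _ (cofactor r M c)) (trans (sym (sum-* (suc n) (cofactor r M c) (λ k → g k * V k c)))
           (sum-cong (suc n) (λ k → solve 3 (λ x y z → x :* (y :* z) := y :* (z :* x)) refl (cofactor r M c) (g k) (V k c))))) ⟩
    sumℤ (suc n) (λ c → sumℤ (suc n) (λ k → g k * (V k c * cofactor r M c)))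
      ≡⟨ sum-swap (suc n) (suc n) (λ c k → g k * (V k c * cofactor r M c)) ⟩
    sumℤ (suc n) (λ k → sumℤ (suc n) (λ c → g k * (V k c * cofactor r M c)))
      ≡⟨ sum-cong (suc n) (λ k → trans (sum-* (suc n) (g k) (λ c → V k c * cofactor r M c))
                                       (cong (g k *_) (sym (det-setRow n r (V k) M)))) ⟩
    sumℤ (suc n) (λ k → g k * det (suc n) (setRow r (V k) M)) ∎

  swapIndex : ∀ {n} → Fin n → Fin n → Fin n → Fin n
  swapIndex r s a = if does (a Fin.≟ r) then s else (if does (a Fin.≟ s) then r else a)

  -- With
  -- B u w = det (rows r, s replaced by u, w), B is bilinear and vanishes on the
  -- diagonal, so B x y + B y x = B (x⊕y) (x⊕y) - B x x - B y y = 0.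
  det-swapRows : ∀ n (r s : Fin (suc n)) (N : Matrix (suc n)) → r ≢ s →
    det (suc n) (λ a b → N (swapIndex r s a) b) ≡ - det (suc n) N
  det-swapRows n r s N r≢s = begin
    det (suc n) (λ a b → N (swapIndex r s a) b)   ≡⟨ det-cong (suc n) swapped ⟨
    B y x                                         ≡⟨ solve 2 (λ p q → q := (q :+ p) :- p) refl (B x y) (B y x) ⟩
    (B y x + B x y) - B x y                       ≡⟨ cong₂ _-_ (trans (+-comm (B y x) (B x y)) polarization)
                                                               (det-cong (suc n) restored) ⟩
    0ℤ - det (suc n) N                            ≡⟨ +-identityˡ _ ⟩
    - det (suc n) N ∎
    where
    B : (Fin (suc n) → ℤ) → (Fin (suc n) → ℤ) → ℤ
    B u w = det (suc n) (setRow r u (setRow s w N))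
    x = N r
    y = N s
    setRows-comm : ∀ u w a b → setRow r u (setRow s w N) a b ≡ setRow s w (setRow r u N) a b
    setRows-comm u w a b with a Fin.≟ r | a Fin.≟ s
    ... | yes refl | yes refl = contradiction refl r≢s
    ... | yes refl | no _ = refl
    ... | no _ | yes refl = refl
    ... | no _ | no _ = refl
    linearˡ : ∀ u₁ u₂ w → B (λ b → u₁ b + u₂ b) w ≡ B u₁ w + B u₂ w
    linearˡ u₁ u₂ w = det-setRow-+ n r u₁ u₂ (setRow s w N)
    linearʳ : ∀ u w₁ w₂ → B u (λ b → w₁ b + w₂ b) ≡ B u w₁ + B u w₂
    linearʳ u w₁ w₂ = begin
      B u (λ b → w₁ b + w₂ b)
        ≡⟨ det-cong (suc n) (setRows-comm u (λ b → w₁ b + w₂ b)) ⟩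
      det (suc n) (setRow s (λ b → w₁ b + w₂ b) (setRow r u N))
        ≡⟨ det-setRow-+ n s w₁ w₂ (setRow r u N) ⟩
      det (suc n) (setRow s w₁ (setRow r u N)) + det (suc n) (setRow s w₂ (setRow r u N))
        ≡⟨ cong₂ _+_ (det-cong (suc n) (setRows-comm u w₁)) (det-cong (suc n) (setRows-comm u w₂)) ⟨
      B u w₁ + B u w₂ ∎
    diagonal : ∀ u → B u u ≡ 0ℤ
    diagonal u = det-equalRows n (setRow r u (setRow s u N)) r s r≢s (λ b →
      trans (setRow-at r u (setRow s u N) b)
            (sym (trans (setRow-off r s u (setRow s u N) b (r≢s ∘ sym)) (setRow-at s u N b))))
    x⊕y : Fin (suc n) → ℤ
    x⊕y b = x b + y b
    polarization : B x y + B y x ≡ 0ℤ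
    polarization = begin
      B x y + B y x
        ≡⟨ solve 4 (λ a b c d → a :+ b := ((c :+ a) :+ (b :+ d)) :- (c :+ d)) refl (B x y) (B y x) (B x x) (B y y) ⟩
      ((B x x + B x y) + (B y x + B y y)) - (B x x + B y y)
        ≡⟨ cong₂ (λ u v → (u + v) - (B x x + B y y)) (linearʳ x x y) (linearʳ y x y) ⟨
      (B x x⊕y + B y x⊕y) - (B x x + B y y)
        ≡⟨ cong (_- (B x x + B y y)) (linearˡ x y x⊕y) ⟨
      B x⊕y x⊕y - (B x x + B y y)
        ≡⟨ cong₂ _-_ (diagonal x⊕y) (cong₂ _+_ (diagonal x) (diagonal y)) ⟩
      0ℤ ∎
    restored : ∀ a b → setRow r x (setRow s y N) a b ≡ N a b
    restored a b with a Fin.≟ r | a Fin.≟ s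
    ... | yes refl | _ = refl
    ... | no _ | yes refl = refl
    ... | no _ | no _ = refl
    swapped : ∀ a b → setRow r y (setRow s x N) a b ≡ N (swapIndex r s a) b
    swapped a b with a Fin.≟ r | a Fin.≟ s
    ... | yes refl | _ = refl
    ... | no _ | yes refl = refl
    ... | no _ | no _ = refl

  -- Expansion along the first column, by induction: expand the first row, then
  -- the first column of every minor, and exchange the two summations.
  laplace-firstColumn : ∀ n (M : Matrix (suc n)) →
    det (suc n) M ≡ sumℤ (suc n) (λ a → sign (toℕ a) * (M a zero * det n (minor a zero M)))
  laplace-firstColumn zero M = refl
  laplace-firstColumn (suc n) M = cong (_+_ (sign 0 * (M zero zero * det (suc n) (minor zero zero M)))) (begin
    sumℤ (suc n) (λ j → sign (toℕ (suc j)) * (M zero (suc j) * det (suc n) (minor zero (suc j) M)))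
      ≡⟨ sum-cong (suc n) (λ j → cong (λ x → sign (toℕ (suc j)) * (M zero (suc j) * x)) (laplace-firstColumn n (minor zero (suc j) M))) ⟩
    sumℤ (suc n) (λ j → - sign (toℕ j) * (M zero (suc j) * sumℤ (suc n) (λ a → sign (toℕ a) * (M (suc a) zero * D a j))))
      ≡⟨ sum-cong (suc n) (λ j → pull-constants (suc n) (- sign (toℕ j)) (M zero (suc j)) (λ a → sign (toℕ a) * (M (suc a) zero * D a j))) ⟩
    sumℤ (suc n) (λ j → sumℤ (suc n) (λ a → T j a))
      ≡⟨ sum-swap (suc n) (suc n) T ⟩
    sumℤ (suc n) (λ a → sumℤ (suc n) (λ j → T j a))
      ≡⟨ sum-cong (suc n) (λ a → sum-cong (suc n) (λ j →
           solve 5 (λ s t x y d → (:- s) :* (x :* (t :* (y :* d))) := (:- t) :* (y :* (s :* (x :* d)))) refl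
             (sign (toℕ j)) (sign (toℕ a)) (M zero (suc j)) (M (suc a) zero) (D a j))) ⟩
    sumℤ (suc n) (λ a → sumℤ (suc n) (λ j → - sign (toℕ a) * (M (suc a) zero * (sign (toℕ j) * (M zero (suc j) * D a j)))))
      ≡⟨ sum-cong (suc n) (λ a → sym (pull-constants (suc n) (- sign (toℕ a)) (M (suc a) zero) (λ j → sign (toℕ j) * (M zero (suc j) * D a j)))) ⟩
    sumℤ (suc n) (λ a → sign (toℕ (suc a)) * (M (suc a) zero * det (suc n) (minor (suc a) zero M))) ∎)
    where
    -- the minor deleting rows 0, a + 1 and columns 0, j + 1
    D : Fin (suc n) → Fin (suc n) → ℤ
    D a j = det n (λ x y → M (suc (punchIn a x)) (suc (punchIn j y)))
    T : Fin (suc n) → Fin (suc n) → ℤ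
    T j a = - sign (toℕ j) * (M zero (suc j) * (sign (toℕ a) * (M (suc a) zero * D a j)))

  _ᵀ : ∀ {n} → Matrix n → Matrix n
  (M ᵀ) a b = M b a

  det-transpose : ∀ n (M : Matrix n) → det n (M ᵀ) ≡ det n M
  det-transpose zero M = refl
  det-transpose (suc n) M = trans
    (sum-cong (suc n) (λ j → cong (λ x → sign (toℕ j) * (M j zero * x)) (det-transpose n (λ a b → M (punchIn j a) (suc b)))))
    (sym (laplace-firstColumn n M))

  identity : ∀ {n} → Matrix n
  identity a c = ind (a Fin.≟ c)

  det-identity : ∀ n → det n identity ≡ 1ℤ
  det-identity zero = refl
  det-identity (suc n) = cong₂ _+_
    (trans (*-identityˡ _) (trans (*-identityˡ _) (det-identity n)))
    (sum-zero n _ (λ j → trans (cong (sign (suc (toℕ j)) *_) (*-zeroˡ (det n (λ a b → identity {suc n} (suc a) (punchIn (suc j) b)))))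
                               (*-zeroʳ (sign (suc (toℕ j))))))

  _·_ : ∀ {n} → Matrix n → Matrix n → Matrix n
  _·_ {n} A B a c = sumℤ n (λ b → A a b * B b c)

  ·-identityʳ : ∀ n (A : Matrix n) a c → (A · identity) a c ≡ A a c
  ·-identityʳ n A a c = trans (sum-cong n (λ b → *-comm (A a b) (identity b c))) (sum-delta n c (A a))

  selectRows : ∀ {n} → (Fin n → Fin n) → Matrix n → Matrix n
  selectRows f B a c = B (f a) c

  -- If f is not surjective it is not injective and both sides vanish; otherwise
  -- f is sorted into the identity by row swaps, one position at a time.
  private
    Fixes : ∀ {n} → ℕ → (Fin n → Fin n) → Set
    Fixes d f = ∀ r → toℕ r ℕ.< d → f r ≡ r

    SelectRowsFactor : ∀ n → Matrix (suc n) → (Fin (suc n) → Fin (suc n)) → Set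
    SelectRowsFactor n B f = det (suc n) (selectRows f B) ≡ det (suc n) (selectRows f identity) * det (suc n) B

    selectRows-collision : ∀ n B f (a b : Fin (suc n)) → a ≢ b → f a ≡ f b → SelectRowsFactor n B f
    selectRows-collision n B f a b a≢b fa≡fb = trans
      (det-equalRows n (selectRows f B) a b a≢b (λ c → cong (λ x → B x c) fa≡fb))
      (sym (trans (cong (_* det (suc n) B) (det-equalRows n (selectRows f identity) a b a≢b (λ c → cong (λ x → identity x c) fa≡fb)))
                  (*-zeroˡ (det (suc n) B))))

    selectRows-swap : ∀ n B f (r s : Fin (suc n)) → r ≢ s → SelectRowsFactor n B (f ∘ swapIndex r s) → SelectRowsFactor n B f
    selectRows-swap n B f r s r≢s claim = begin
      X                                   ≡⟨ neg-involutive X ⟨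
      - - X                               ≡⟨ cong -_ (det-swapRows n r s (selectRows f B) r≢s) ⟨
      - det (suc n) (selectRows (f ∘ swapIndex r s) B)
                                          ≡⟨ cong -_ claim ⟩
      - (det (suc n) (selectRows (f ∘ swapIndex r s) identity) * det (suc n) B)
                                          ≡⟨ cong (λ x → - (x * det (suc n) B)) (det-swapRows n r s (selectRows f identity) r≢s) ⟩
      - (- Y * det (suc n) B)             ≡⟨ solve 2 (λ y b → :- ((:- y) :* b) := y :* b) refl Y (det (suc n) B) ⟩
      Y * det (suc n) B ∎
      where
      X = det (suc n) (selectRows f B)
      Y = det (suc n) (selectRows f identity)

    swapIndex-left : ∀ {n} (r s : Fin n) → swapIndex r s r ≡ s
    swapIndex-left r s with r Fin.≟ r
    ... | yes _ = refl
    ... | no r≢r = contradiction refl r≢r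

    swapIndex-other : ∀ {n} (r s a : Fin n) → a ≢ r → a ≢ s → swapIndex r s a ≡ a
    swapIndex-other r s a a≢r a≢s with a Fin.≟ r
    ... | yes a≡r = contradiction a≡r a≢r
    ... | no _ with a Fin.≟ s
    ... | yes a≡s = contradiction a≡s a≢s
    ... | no _ = refl

    below-or-at : ∀ {n} {d} (r r₀ : Fin n) → toℕ r₀ ≡ d → toℕ r ℕ.< suc d → toℕ r ℕ.< d ⊎ r ≡ r₀
    below-or-at r r₀ r₀≡d r<1+d with ℕP.m<1+n⇒m<n∨m≡n r<1+d
    ... | inj₁ r<d = inj₁ r<d
    ... | inj₂ r≡d = inj₂ (toℕ-injective (trans r≡d (sym r₀≡d)))

    -- one sorting step: make f fix the index r₀ (of value d) as well
    selectRows-step : ∀ n B d (r₀ : Fin (suc n)) → toℕ r₀ ≡ d →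
      (∀ g → Fixes (suc d) g → SelectRowsFactor n B g) → ∀ f → Fixes d f → SelectRowsFactor n B f
    selectRows-step n B d r₀ r₀≡d sorted f fixes with any? (λ s → f s Fin.≟ r₀)
    ... | no r₀∉image = selectRows-collision n B f a b (ℕP.<⇒≢ a<b ∘ cong toℕ)
                          (punchOut-injective (avoid a) (avoid b) fa≡fb)
      where
      avoid : ∀ a → r₀ ≢ f a
      avoid a r₀≡fa = r₀∉image (a , sym r₀≡fa)
      collision = pigeonhole (ℕP.n<1+n n) (λ a → punchOut (avoid a))
      a = proj₁ collision
      b = proj₁ (proj₂ collision)
      a<b = proj₁ (proj₂ (proj₂ collision))
      fa≡fb = proj₂ (proj₂ (proj₂ collision))
    ... | yes (s , fs≡r₀) with s Fin.≟ r₀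
    ...   | yes refl = sorted f fixes′
      where
      fixes′ : Fixes (suc d) f
      fixes′ r r<1+d with below-or-at r r₀ r₀≡d r<1+d
      ... | inj₁ r<d = fixes r r<d
      ... | inj₂ refl = fs≡r₀
    ...   | no s≢r₀ = selectRows-swap n B f r₀ s (s≢r₀ ∘ sym) (sorted (f ∘ swapIndex r₀ s) fixes′)
      where
      fixes′ : Fixes (suc d) (f ∘ swapIndex r₀ s)
      fixes′ r r<1+d with below-or-at r r₀ r₀≡d r<1+d
      ... | inj₂ refl = trans (cong f (swapIndex-left r₀ s)) fs≡r₀
      ... | inj₁ r<d = trans (cong f (swapIndex-other r₀ s r r≢r₀ r≢s)) (fixes r r<d)
        where
        r≢r₀ : r ≢ r₀
        r≢r₀ r≡r₀ = ℕP.<-irrefl (trans (cong toℕ r≡r₀) r₀≡d) r<d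
        r≢s : r ≢ s
        r≢s refl = r≢r₀ (trans (sym (fixes r r<d)) fs≡r₀)

    -- the k indices from d on still have to be sorted
    selectRows-sort : ∀ n B k d → k ℕ.+ d ≡ suc n → ∀ f → Fixes d f → SelectRowsFactor n B f
    selectRows-sort n B zero d refl f fixes = trans
      (det-cong (suc n) (λ a c → cong (λ x → B x c) (fixes a (toℕ<n a))))
      (sym (trans (cong (_* det (suc n) B) (trans (det-cong (suc n) (λ a c → cong (λ x → identity x c) (fixes a (toℕ<n a))))
                                                   (det-identity (suc n))))
                  (*-identityˡ _)))
    selectRows-sort n B (suc k) d k+d≡n = selectRows-step n B d (fromℕ< d<1+n) (toℕ-fromℕ< d<1+n)
      (selectRows-sort n B k (suc d) (trans (ℕP.+-suc k d) k+d≡n))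
      where
      d<1+n : d ℕ.< suc n
      d<1+n = ℕP.≤-trans (ℕP.m≤n+m (suc d) k) (ℕP.≤-reflexive (trans (ℕP.+-suc k d) k+d≡n))

  det-selectRows : ∀ n (B : Matrix (suc n)) (f : Fin (suc n) → Fin (suc n)) →
    det (suc n) (selectRows f B) ≡ det (suc n) (selectRows f identity) * det (suc n) B
  det-selectRows n B f = selectRows-sort n B (suc n) 0 (ℕP.+-identityʳ (suc n)) f (λ r ())

  -- Multiplicativity, by expanding the rows of A · B one at a time.
  -- mixed A X m f: rows below m are rows of A · X, row a ≥ m is row f a of X.
  choose : ∀ {P : Set} → Dec P → ℤ → ℤ → ℤ
  choose (yes _) x y = x
  choose (no _) x y = y

  mixed : ∀ {n} → Matrix n → Matrix n → ℕ → (Fin n → Fin n) → Matrix n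
  mixed A X m f a c = choose (toℕ a ℕ.<? m) ((A · X) a c) (X (f a) c)

  redirect : ∀ {n} → (Fin n → Fin n) → Fin n → Fin n → Fin n → Fin n
  redirect f r k a = if does (a Fin.≟ r) then k else f a

  private
    redirect-at : ∀ {n} (f : Fin n → Fin n) r k → redirect f r k r ≡ k
    redirect-at f r k with r Fin.≟ r
    ... | yes _ = refl
    ... | no r≢r = contradiction refl r≢r

    redirect-off : ∀ {n} (f : Fin n → Fin n) r k a → a ≢ r → redirect f r k a ≡ f a
    redirect-off f r k a a≢r with a Fin.≟ r
    ... | yes a≡r = contradiction a≡r a≢r
    ... | no _ = refl

    mixed-low : ∀ {n} (A X : Matrix n) m f a c → toℕ a ℕ.< m → mixed A X m f a c ≡ (A · X) a c
    mixed-low A X m f a c a<m with toℕ a ℕ.<? m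
    ... | yes _ = refl
    ... | no a≮m = contradiction a<m a≮m

    mixed-high : ∀ {n} (A X : Matrix n) m f a c → ¬ toℕ a ℕ.< m → mixed A X m f a c ≡ X (f a) c
    mixed-high A X m f a c a≮m with toℕ a ℕ.<? m
    ... | yes a<m = contradiction a<m a≮m
    ... | no _ = refl

    -- expanding row m, which is a linear combination of rows of X
    det-mixed-step : ∀ n (A X : Matrix (suc n)) m (m<n : m ℕ.< suc n) f →
      det (suc n) (mixed A X (suc m) f) ≡
      sumℤ (suc n) (λ k → A (fromℕ< m<n) k * det (suc n) (mixed A X m (redirect f (fromℕ< m<n) k)))
    det-mixed-step n A X m m<n f = begin
      det (suc n) (mixed A X (suc m) f)
        ≡⟨ det-cong (suc n) row-m-expanded ⟩
      det (suc n) (setRow r ((A · X) r) (mixed A X m f))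
        ≡⟨ det-setRow-sum n r (A r) X (mixed A X m f) ⟩
      sumℤ (suc n) (λ k → A r k * det (suc n) (setRow r (X k) (mixed A X m f)))
        ≡⟨ sum-cong (suc n) (λ k → cong (A r k *_) (det-cong (suc n) (row-m-selected k))) ⟩
      sumℤ (suc n) (λ k → A r k * det (suc n) (mixed A X m (redirect f r k))) ∎
      where
      r = fromℕ< m<n
      r≡m : toℕ r ≡ m
      r≡m = toℕ-fromℕ< m<n
      row-m-expanded : ∀ a c → mixed A X (suc m) f a c ≡ setRow r ((A · X) r) (mixed A X m f) a c
      row-m-expanded a c = byRow a (a Fin.≟ r)
        where
        byRow : ∀ a → Dec (a ≡ r) → mixed A X (suc m) f a c ≡ setRow r ((A · X) r) (mixed A X m f) a c
        byRow a (yes refl) = trans (mixed-low A X (suc m) f r c (ℕP.≤-reflexive (cong suc r≡m)))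
                                   (sym (setRow-at r ((A · X) r) (mixed A X m f) c))
        byRow a (no a≢r) = trans (unchanged (toℕ a ℕ.<? m)) (sym (setRow-off r a ((A · X) r) (mixed A X m f) c a≢r))
          where
          unchanged : Dec (toℕ a ℕ.< m) → mixed A X (suc m) f a c ≡ mixed A X m f a c
          unchanged (yes a<m) = trans (mixed-low A X (suc m) f a c (ℕP.m<n⇒m<1+n a<m)) (sym (mixed-low A X m f a c a<m))
          unchanged (no a≮m) = trans (mixed-high A X (suc m) f a c a≮1+m) (sym (mixed-high A X m f a c a≮m))
            where
            a≮1+m : ¬ toℕ a ℕ.< suc m
            a≮1+m a<1+m with below-or-at a r r≡m a<1+m
            ... | inj₁ a<m = a≮m a<m
            ... | inj₂ a≡r = a≢r a≡r
      row-m-selected : ∀ k a c → setRow r (X k) (mixed A X m f) a c ≡ mixed A X m (redirect f r k) a c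
      row-m-selected k a c = byRow a (a Fin.≟ r)
        where
        byRow : ∀ a → Dec (a ≡ r) → setRow r (X k) (mixed A X m f) a c ≡ mixed A X m (redirect f r k) a c
        byRow a (yes refl) = trans (setRow-at r (X k) (mixed A X m f) c)
          (sym (trans (mixed-high A X m (redirect f r k) r c (λ r<m → ℕP.<-irrefl r≡m r<m))
                      (cong (λ x → X x c) (redirect-at f r k))))
        byRow a (no a≢r) = trans (setRow-off r a (X k) (mixed A X m f) c a≢r) (unchanged (toℕ a ℕ.<? m))
          where
          unchanged : Dec (toℕ a ℕ.< m) → mixed A X m f a c ≡ mixed A X m (redirect f r k) a c
          unchanged (yes a<m) = trans (mixed-low A X m f a c a<m) (sym (mixed-low A X m (redirect f r k) a c a<m))
          unchanged (no a≮m) = trans (mixed-high A X m f a c a≮m)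
            (sym (trans (mixed-high A X m (redirect f r k) a c a≮m) (cong (λ x → X x c) (redirect-off f r k a a≢r))))

    det-mixed-factor : ∀ n (A B : Matrix (suc n)) m → m ℕ.≤ suc n → ∀ f →
      det (suc n) (mixed A B m f) ≡ det (suc n) (mixed A identity m f) * det (suc n) B
    det-mixed-factor n A B zero _ f = begin
      det (suc n) (mixed A B 0 f)                              ≡⟨ det-cong (suc n) (λ a c → mixed-high A B 0 f a c λ ()) ⟩
      det (suc n) (selectRows f B)                             ≡⟨ det-selectRows n B f ⟩
      det (suc n) (selectRows f identity) * det (suc n) B      ≡⟨ cong (_* det (suc n) B) (det-cong (suc n) (λ a c → mixed-high A identity 0 f a c λ ())) ⟨
      det (suc n) (mixed A identity 0 f) * det (suc n) B ∎
    det-mixed-factor n A B (suc m) m<n f = begin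
      det (suc n) (mixed A B (suc m) f)
        ≡⟨ det-mixed-step n A B m m<n f ⟩
      sumℤ (suc n) (λ k → A r k * det (suc n) (mixed A B m (redirect f r k)))
        ≡⟨ sum-cong (suc n) (λ k → trans (cong (A r k *_) (det-mixed-factor n A B m (ℕP.<⇒≤ m<n) (redirect f r k)))
                                         (sym (*-assoc (A r k) (det (suc n) (mixed A identity m (redirect f r k))) (det (suc n) B)))) ⟩
      sumℤ (suc n) (λ k → A r k * det (suc n) (mixed A identity m (redirect f r k)) * det (suc n) B)
        ≡⟨ sum-*ʳ (λ k → A r k * det (suc n) (mixed A identity m (redirect f r k))) ⟩
      sumℤ (suc n) (λ k → A r k * det (suc n) (mixed A identity m (redirect f r k))) * det (suc n) B
        ≡⟨ cong (_* det (suc n) B) (det-mixed-step n A identity m m<n f) ⟨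
      det (suc n) (mixed A identity (suc m) f) * det (suc n) B ∎
      where
      r = fromℕ< m<n
      sum-*ʳ : ∀ g → sumℤ (suc n) (λ k → g k * det (suc n) B) ≡ sumℤ (suc n) g * det (suc n) B
      sum-*ʳ g = trans (sum-cong (suc n) (λ k → *-comm (g k) (det (suc n) B)))
                       (trans (sum-* (suc n) (det (suc n) B) g) (*-comm (det (suc n) B) (sumℤ (suc n) g)))

  det-· : ∀ n (A B : Matrix (suc n)) → det (suc n) (A · B) ≡ det (suc n) A * det (suc n) B
  det-· n A B = begin
    det (suc n) (A · B)                                         ≡⟨ det-cong (suc n) (all-low B) ⟨
    det (suc n) (mixed A B (suc n) id)                          ≡⟨ det-mixed-factor n A B (suc n) ℕP.≤-refl id ⟩
    det (suc n) (mixed A identity (suc n) id) * det (suc n) B   ≡⟨ cong (_* det (suc n) B) (det-cong (suc n) (λ a c →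
                                                                     trans (all-low identity a c) (·-identityʳ (suc n) A a c))) ⟩
    det (suc n) A * det (suc n) B ∎
    where
    all-low : ∀ X a c → mixed A X (suc n) id a c ≡ (A · X) a c
    all-low X a c = mixed-low A X (suc n) id a c (toℕ<n a)

  det-scale : ∀ n (c : ℕ) (M : Matrix n) → det n (λ a b → + c * M a b) ≡ + (c ℕ.^ n) * det n M
  det-scale zero c M = sym (*-identityˡ _)
  det-scale (suc n) c M = begin
    sumℤ (suc n) (λ j → sign (toℕ j) * ((+ c * M zero j) * det n (λ a b → + c * M (suc a) (punchIn j b))))
      ≡⟨ sum-cong (suc n) (λ j → trans (cong (λ x → sign (toℕ j) * ((+ c * M zero j) * x)) (det-scale n c (minor zero j M)))
           (solve 5 (λ s m c p d → s :* ((c :* m) :* (p :* d)) := (c :* p) :* (s :* (m :* d))) refl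
             (sign (toℕ j)) (M zero j) (+ c) (+ (c ℕ.^ n)) (det n (minor zero j M)))) ⟩
    sumℤ (suc n) (λ j → (+ c * + (c ℕ.^ n)) * (sign (toℕ j) * (M zero j * det n (minor zero j M))))
      ≡⟨ sum-* (suc n) (+ c * + (c ℕ.^ n)) (λ j → sign (toℕ j) * (M zero j * det n (minor zero j M))) ⟩
    (+ c * + (c ℕ.^ n)) * det (suc n) M
      ≡⟨ cong (_* det (suc n) M) (pos-* c (c ℕ.^ n)) ⟨
    + (c ℕ.^ suc n) * det (suc n) M ∎

  -- Indeed (det W)² det M = cⁿ det M' and symmetrically,
  -- so ((det W)² + cⁿ) (det M - det M') = 0 with a positive first factor.
  -- (W need not be known to be invertible.)
  det-exchangedBySandwich : ∀ n (c : ℕ) .{{_ : ℕ.NonZero c}} (M M′ W : Matrix n) →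
    (∀ a b → (W · (M · (W ᵀ))) a b ≡ + c * M′ a b) →
    (∀ a b → (W · (M′ · (W ᵀ))) a b ≡ + c * M a b) →
    det n M ≡ det n M′
  det-exchangedBySandwich zero c M M′ W conj conj′ = refl
  det-exchangedBySandwich (suc n) c M M′ W conj conj′ = i-j≡0⇒i≡j dM dM′ (cancel (i*j≡0⇒i≡0∨j≡0 (K + s) key))
    where
    N = suc n
    dW = det N W
    dM = det N M
    dM′ = det N M′
    K = dW * dW
    s = + (c ℕ.^ N)
    sandwich : ∀ X → det N (W · (X · (W ᵀ))) ≡ K * det N X
    sandwich X = begin
      det N (W · (X · (W ᵀ)))        ≡⟨ det-· n W (X · (W ᵀ)) ⟩
      dW * det N (X · (W ᵀ))         ≡⟨ cong (dW *_) (det-· n X (W ᵀ)) ⟩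
      dW * (det N X * det N (W ᵀ))   ≡⟨ cong (λ z → dW * (det N X * z)) (det-transpose N W) ⟩
      dW * (det N X * dW)            ≡⟨ solve 2 (λ a b → a :* (b :* a) := (a :* a) :* b) refl dW (det N X) ⟩
      K * det N X ∎
    e : K * dM ≡ s * dM′
    e = trans (sym (sandwich M)) (trans (det-cong N conj) (det-scale N c M′))
    e′ : K * dM′ ≡ s * dM
    e′ = trans (sym (sandwich M′)) (trans (det-cong N conj′) (det-scale N c M))
    key : (K + s) * (dM - dM′) ≡ 0ℤ
    key = begin
      (K + s) * (dM - dM′)                    ≡⟨ solve 4 (λ k s a b → (k :+ s) :* (a :- b) := (k :* a :- s :* b) :+ (s :* a :- k :* b)) refl K s dM dM′ ⟩
      (K * dM - s * dM′) + (s * dM - K * dM′) ≡⟨ cong₂ _+_ (i≡j⇒i-j≡0 e) (i≡j⇒i-j≡0 (sym e′)) ⟩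
      0ℤ ∎
    square : ∀ w → Σ ℕ (λ a → w * w ≡ + a)
    square (+ m) = m ℕ.* m , sym (pos-* m m)
    square -[1+ m ] = suc m ℕ.* suc m , refl
    K+s≢0 : K + s ≢ 0ℤ
    K+s≢0 eq with square dW
    ... | a , K≡a = ℕP.>⇒≢ (ℕP.<-≤-trans (ℕP.m^n>0 c N) (ℕP.m≤n+m (c ℕ.^ N) a))
                             (+-injective (trans (cong (_+ s) (sym K≡a)) eq))
    cancel : K + s ≡ 0ℤ ⊎ dM - dM′ ≡ 0ℤ → dM - dM′ ≡ 0ℤ
    cancel (inj₁ K+s≡0) = contradiction K+s≡0 K+s≢0
    cancel (inj₂ d≡0) = d≡0

-- Arithmetic of the labels of a q-cycle: congruences modulo q, successor and
-- predecessor, the degree of the cycle and its reflections.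
module CyclicOrder where

  open import Defs using (succAdj; cycAdj; sumℤ)
  open FiniteSums using (sum-cong; sum-+; sum-indicator; ind)
  open import Data.Nat as ℕ using (ℕ; suc)
  import Data.Nat.Properties as ℕP
  import Data.Nat.Divisibility as ℕ∣
  open import Data.Fin as Fin using (Fin; toℕ; fromℕ<)
  open import Data.Fin.Properties using (toℕ-fromℕ<; toℕ-injective; toℕ<n)
  open import Data.Integer using (ℤ; +_; -_; _+_; _*_; _-_; 0ℤ; 1ℤ; ∣_∣)
  open import Data.Integer.Properties
    using (+-inverseʳ; m-n≡m⊖n; ∣m⊝n∣≤m⊔n; ∣i∣≡0⇒i≡0; i-j≡0⇒i≡j; +-injective)
  open import Data.Integer.Divisibility.Signed
    using (_∣_; divides; ∣⇒∣ᵤ; ∣m∣n⇒∣m+n; ∣m⇒∣-m)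
  open import Data.Integer.DivMod using (_%ℕ_; _/ℕ_; n%ℕd<d; a≡a%ℕn+[a/ℕn]*n)
  open import Data.Integer.Solver using (module +-*-Solver)
  open +-*-Solver
  open import Data.Bool using (Bool; true; false; _∨_; _∧_; if_then_else_)
  open import Data.Bool.Properties using (∨-zeroʳ; ⇔→≡)
  open import Data.Sum using (_⊎_; inj₁; inj₂; [_,_])
  open import Data.Product using (_,_; _×_)
  open import Function using (_∘_; _$_; _⇔_; mk⇔; Equivalence)
  open import Relation.Nullary using (¬_; Dec; does; yes; no; contradiction)
  open import Relation.Nullary.Decidable using (dec-true)
  open import Relation.Binary.PropositionalEquality hiding ([_])
  open ≡-Reasoning

  does-true : ∀ {P : Set} (d : Dec P) → does d ≡ true → P
  does-true (yes p) _ = p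

  ∨-true : ∀ {a b} → a ∨ b ≡ true → a ≡ true ⊎ b ≡ true
  ∨-true {true} _ = inj₁ refl
  ∨-true {false} b≡true = inj₂ b≡true

  ∨-∧-true : ∀ {a b c} → a ∨ (b ∧ c) ≡ true → a ≡ true ⊎ (b ≡ true × c ≡ true)
  ∨-∧-true {true} _ = inj₁ refl
  ∨-∧-true {false} {true} {true} _ = inj₂ (refl , refl)

  ¬-true : ∀ {a} → ¬ (a ≡ true) → a ≡ false
  ¬-true {false} _ = refl
  ¬-true {true} ¬t = contradiction refl ¬t

  b2z : Bool → ℤ
  b2z b = if b then 1ℤ else 0ℤ

  module _ (p : ℕ) where

    q : ℕ
    q = suc (suc (suc p))

    ⟪_⟫ : Fin q → ℤ
    ⟪ k ⟫ = + toℕ k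

    -- congruence modulo q (a record, so that x and y are recoverable from x ≈ y)
    infix 4 _≈_
    record _≈_ (x y : ℤ) : Set where
      constructor mod
      field divides-difference : + q ∣ x - y

    ≈-reflexive : ∀ {x y} → x ≡ y → x ≈ y
    ≈-reflexive {x} refl = mod (divides 0ℤ (+-inverseʳ x))

    ≈-sym : ∀ {x y} → x ≈ y → y ≈ x
    ≈-sym {x} {y} (mod d) = mod $ subst (_∣_ (+ q)) (solve 2 (λ x y → :- (x :- y) := y :- x) refl x y) (∣m⇒∣-m d)

    ≈-trans : ∀ {x y z} → x ≈ y → y ≈ z → x ≈ z
    ≈-trans {x} {y} {z} (mod d) (mod e) = mod $ subst (_∣_ (+ q)) (solve 3 (λ x y z → (x :- y) :+ (y :- z) := x :- z) refl x y z) (∣m∣n⇒∣m+n d e)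

    ≈-+ : ∀ {x y x′ y′} → x ≈ y → x′ ≈ y′ → x + x′ ≈ y + y′
    ≈-+ {x} {y} {x′} {y′} (mod d) (mod e) = mod $
      subst (_∣_ (+ q)) (solve 4 (λ x y x′ y′ → (x :- y) :+ (x′ :- y′) := (x :+ x′) :- (y :+ y′)) refl x y x′ y′) (∣m∣n⇒∣m+n d e)

    ≈-neg : ∀ {x y} → x ≈ y → - x ≈ - y
    ≈-neg {x} {y} (mod d) = mod $ subst (_∣_ (+ q)) (solve 2 (λ x y → :- (x :- y) := (:- x) :- (:- y)) refl x y) (∣m⇒∣-m d)

    ≈-q : + q ≈ 0ℤ
    ≈-q = mod (divides 1ℤ refl)

    -- Two labels are equal as soon as their values are congruent: their
    -- difference is a multiple of q of absolute value less than q.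
    labels-≈ : ∀ {k l : Fin q} → ⟪ k ⟫ ≈ ⟪ l ⟫ → k ≡ l
    labels-≈ {k} {l} (mod d) with ∣ ⟪ k ⟫ - ⟪ l ⟫ ∣ ℕ.≟ 0
    ... | yes ∣k-l∣≡0 = toℕ-injective (+-injective (i-j≡0⇒i≡j ⟪ k ⟫ ⟪ l ⟫ (∣i∣≡0⇒i≡0 ∣k-l∣≡0)))
    ... | no ∣k-l∣≢0 = contradiction (ℕ∣.∣⇒≤ {{ℕ.≢-nonZero ∣k-l∣≢0}} (∣⇒∣ᵤ d)) (ℕP.<⇒≱ ∣k-l∣<q)
      where
      ∣k-l∣<q : ∣ ⟪ k ⟫ - ⟪ l ⟫ ∣ ℕ.< q
      ∣k-l∣<q = ℕP.≤-<-trans (subst (λ z → ∣ z ∣ ℕ.≤ toℕ k ℕ.⊔ toℕ l) (sym (m-n≡m⊖n (toℕ k) (toℕ l))) (∣m⊝n∣≤m⊔n (toℕ k) (toℕ l)))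
                             (ℕP.⊔-lub (toℕ<n k) (toℕ<n l))

    label : ℤ → Fin q
    label z = fromℕ< (n%ℕd<d z q)

    label-≈ : ∀ z → ⟪ label z ⟫ ≈ z
    label-≈ z = mod $ divides (- (z /ℕ q)) (begin
      ⟪ label z ⟫ - z                         ≡⟨ cong (λ w → + w - z) (toℕ-fromℕ< (n%ℕd<d z q)) ⟩
      + (z %ℕ q) - z                          ≡⟨ cong (λ w → + (z %ℕ q) - w) (a≡a%ℕn+[a/ℕn]*n z q) ⟩
      + (z %ℕ q) - (+ (z %ℕ q) + (z /ℕ q) * + q)
        ≡⟨ solve 3 (λ r d q′ → r :- (r :+ d :* q′) := (:- d) :* q′) refl (+ (z %ℕ q)) (z /ℕ q) (+ q) ⟩
      - (z /ℕ q) * + q ∎)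

    label-unique : ∀ z (k : Fin q) → ⟪ k ⟫ ≈ z → label z ≡ k
    label-unique z k d = labels-≈ (≈-trans (label-≈ z) (≈-sym d))

    next prev : Fin q → Fin q
    next k = label (⟪ k ⟫ + 1ℤ)
    prev k = label (⟪ k ⟫ - 1ℤ)

    prev-next : ∀ k → prev (next k) ≡ k
    prev-next k = label-unique _ k (≈-sym (≈-trans (≈-+ (label-≈ (⟪ k ⟫ + 1ℤ)) (≈-reflexive {x = - 1ℤ} refl))
                    (≈-reflexive (solve 1 (λ x → (x :+ con 1ℤ) :- con 1ℤ := x) refl ⟪ k ⟫))))

    next-prev : ∀ k → next (prev k) ≡ k
    next-prev k = label-unique _ k (≈-sym (≈-trans (≈-+ (label-≈ (⟪ k ⟫ - 1ℤ)) (≈-reflexive {x = 1ℤ} refl))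
                    (≈-reflexive (solve 1 (λ x → (x :- con 1ℤ) :+ con 1ℤ := x) refl ⟪ k ⟫))))

    -- since q ≥ 3, the two neighbours of a label are distinct
    next≢prev : ∀ k → next k ≢ prev k
    next≢prev k next≡prev = contradiction (cong toℕ (labels-≈ {two} {Fin.zero} 2≈0)) (λ ())
      where
      two : Fin q
      two = Fin.suc (Fin.suc Fin.zero)
      neighbours≈ : ⟪ k ⟫ + 1ℤ ≈ ⟪ k ⟫ - 1ℤ
      neighbours≈ = ≈-trans (≈-sym (label-≈ (⟪ k ⟫ + 1ℤ)))
                            (subst (λ z → ⟪ z ⟫ ≈ ⟪ k ⟫ - 1ℤ) (sym next≡prev) (label-≈ (⟪ k ⟫ - 1ℤ)))
      2≈0 : + 2 ≈ 0ℤ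
      2≈0 = ≈-trans (≈-reflexive (solve 1 (λ x → con (+ 2) := (x :+ con 1ℤ) :- (x :- con 1ℤ)) refl ⟪ k ⟫))
                    (≈-trans (≈-+ neighbours≈ (≈-reflexive {x = - (⟪ k ⟫ - 1ℤ)} refl))
                             (≈-reflexive (+-inverseʳ (⟪ k ⟫ - 1ℤ))))

    toℕ-next-< : ∀ k (k+1<q : suc (toℕ k) ℕ.< q) → toℕ (next k) ≡ suc (toℕ k)
    toℕ-next-< k k+1<q = trans (cong toℕ (label-unique _ (fromℕ< k+1<q) (≈-reflexive (begin
      ⟪ fromℕ< k+1<q ⟫     ≡⟨ cong +_ (toℕ-fromℕ< k+1<q) ⟩
      + suc (toℕ k)        ≡⟨ solve 1 (λ x → con 1ℤ :+ x := x :+ con 1ℤ) refl ⟪ k ⟫ ⟩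
      ⟪ k ⟫ + 1ℤ ∎))))
      (toℕ-fromℕ< k+1<q)

    next-last : ∀ k → suc (toℕ k) ≡ q → toℕ (next k) ≡ 0
    next-last k k+1≡q = cong toℕ (label-unique _ Fin.zero (≈-sym (≈-trans (≈-reflexive (begin
      ⟪ k ⟫ + 1ℤ    ≡⟨ solve 1 (λ x → x :+ con 1ℤ := con 1ℤ :+ x) refl ⟪ k ⟫ ⟩
      + suc (toℕ k) ≡⟨ cong +_ k+1≡q ⟩
      + q ∎)) ≈-q)))

    succAdj⇔next : ∀ k l → succAdj k l ≡ true ⇔ l ≡ next k
    succAdj⇔next k l = mk⇔ to from
      where
      to : succAdj k l ≡ true → l ≡ next k
      to adj with ∨-∧-true adj
      ... | inj₁ l≡k+1 = sym (label-unique _ l (≈-reflexive (begin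
        ⟪ l ⟫         ≡⟨ cong +_ (does-true (toℕ l ℕ.≟ suc (toℕ k)) l≡k+1) ⟩
        + suc (toℕ k) ≡⟨ solve 1 (λ x → con 1ℤ :+ x := x :+ con 1ℤ) refl ⟪ k ⟫ ⟩
        ⟪ k ⟫ + 1ℤ ∎)))
      ... | inj₂ (k+1≡q , l≡0) = toℕ-injective (trans (does-true (toℕ l ℕ.≟ 0) l≡0)
                                    (sym (next-last k (does-true (suc (toℕ k) ℕ.≟ q) k+1≡q))))
      from : l ≡ next k → succAdj k l ≡ true
      from refl with ℕP.m≤n⇒m<n∨m≡n (toℕ<n k)
      ... | inj₁ k+1<q = cong (_∨ (does (suc (toℕ k) ℕ.≟ q) ∧ does (toℕ (next k) ℕ.≟ 0))) (dec-true (toℕ (next k) ℕ.≟ suc (toℕ k)) (toℕ-next-< k k+1<q))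
      ... | inj₂ k+1≡q = trans (cong (does (toℕ (next k) ℕ.≟ suc (toℕ k)) ∨_)
                                     (cong₂ _∧_ (dec-true (suc (toℕ k) ℕ.≟ q) k+1≡q) (dec-true (toℕ (next k) ℕ.≟ 0) (next-last k k+1≡q))))
                               (∨-zeroʳ _)

    cycAdj⇔neighbour : ∀ k l → cycAdj k l ≡ true ⇔ (l ≡ next k ⊎ l ≡ prev k)
    cycAdj⇔neighbour k l = mk⇔ to from
      where
      succAdj⇔prev : succAdj l k ≡ true ⇔ l ≡ prev k
      succAdj⇔prev = mk⇔ (λ adj → trans (sym (prev-next l)) (cong prev (sym (Equivalence.to (succAdj⇔next l k) adj))))
                         (λ l≡prev → Equivalence.from (succAdj⇔next l k) (trans (sym (next-prev k)) (cong next (sym l≡prev))))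
      to : cycAdj k l ≡ true → l ≡ next k ⊎ l ≡ prev k
      to adj with ∨-true adj
      ... | inj₁ kl = inj₁ (Equivalence.to (succAdj⇔next k l) kl)
      ... | inj₂ lk = inj₂ (Equivalence.to succAdj⇔prev lk)
      from : l ≡ next k ⊎ l ≡ prev k → cycAdj k l ≡ true
      from (inj₁ l≡next) = cong (_∨ succAdj l k) (Equivalence.from (succAdj⇔next k l) l≡next) 
      from (inj₂ l≡prev) = trans (cong (succAdj k l ∨_) (Equivalence.from succAdj⇔prev l≡prev)) (∨-zeroʳ _)

    cycAdj-indicator : ∀ k l → b2z (cycAdj k l) ≡ ind (l Fin.≟ next k) + ind (l Fin.≟ prev k)
    cycAdj-indicator k l with l Fin.≟ next k | l Fin.≟ prev k
    ... | yes refl | yes l≡prev = contradiction l≡prev (next≢prev k)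
    ... | yes l≡next | no _ = cong b2z (Equivalence.from (cycAdj⇔neighbour k l) (inj₁ l≡next))
    ... | no _ | yes l≡prev = cong b2z (Equivalence.from (cycAdj⇔neighbour k l) (inj₂ l≡prev))
    ... | no l≢next | no l≢prev = cong b2z (¬-true λ adj → [ l≢next , l≢prev ] (Equivalence.to (cycAdj⇔neighbour k l) adj))

    cycle-degree : ∀ k → sumℤ q (λ l → b2z (cycAdj k l)) ≡ + 2
    cycle-degree k = begin
      sumℤ q (λ l → b2z (cycAdj k l))                               ≡⟨ sum-cong q (cycAdj-indicator k) ⟩
      sumℤ q (λ l → ind (l Fin.≟ next k) + ind (l Fin.≟ prev k))    ≡⟨ sum-+ q (λ l → ind (l Fin.≟ next k)) (λ l → ind (l Fin.≟ prev k)) ⟩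
      sumℤ q (λ l → ind (l Fin.≟ next k)) + sumℤ q (λ l → ind (l Fin.≟ prev k))
                                                                    ≡⟨ cong₂ _+_ (sum-indicator q (next k)) (sum-indicator q (prev k)) ⟩
      + 2 ∎

    -- The reflection k ↦ s - k of the cycle reverses its orientation and so
    -- preserves adjacency.
    reflection : ℤ → Fin q → Fin q
    reflection s k = label (s - ⟪ k ⟫)

    reflection-involutive : ∀ s k → reflection s (reflection s k) ≡ k
    reflection-involutive s k = label-unique _ k (≈-sym (≈-trans (≈-+ (≈-reflexive {x = s} refl) (≈-neg (label-≈ (s - ⟪ k ⟫))))
                                  (≈-reflexive (solve 2 (λ s x → s :- (s :- x) := x) refl s ⟪ k ⟫))))

    reflection-swaps : ∀ k l → reflection (⟪ k ⟫ + ⟪ l ⟫) k ≡ l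
    reflection-swaps k l = label-unique _ l (≈-reflexive (solve 2 (λ a b → b := (a :+ b) :- a) refl ⟪ k ⟫ ⟪ l ⟫))

    reflection-next : ∀ s k → reflection s (next k) ≡ prev (reflection s k)
    reflection-next s k = labels-≈ (≈-trans (label-≈ (s - ⟪ next k ⟫)) (≈-trans
      (≈-+ (≈-reflexive {x = s} refl) (≈-neg (label-≈ (⟪ k ⟫ + 1ℤ))))
      (≈-trans (≈-reflexive (solve 2 (λ s x → s :- (x :+ con 1ℤ) := (s :- x) :- con 1ℤ) refl s ⟪ k ⟫))
               (≈-sym (≈-trans (label-≈ (⟪ reflection s k ⟫ - 1ℤ)) (≈-+ (label-≈ (s - ⟪ k ⟫)) (≈-reflexive {x = - 1ℤ} refl)))))))

    reflection-prev : ∀ s k → reflection s (prev k) ≡ next (reflection s k)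
    reflection-prev s k = begin
      reflection s (prev k)                                  ≡⟨ next-prev (reflection s (prev k)) ⟨
      next (prev (reflection s (prev k)))                    ≡⟨ cong next (reflection-next s (prev k)) ⟨
      next (reflection s (next (prev k)))                    ≡⟨ cong (next ∘ reflection s) (next-prev k) ⟩
      next (reflection s k) ∎

    reflection-injective : ∀ s {k l} → reflection s k ≡ reflection s l → k ≡ l
    reflection-injective s {k} {l} e = trans (sym (reflection-involutive s k)) (trans (cong (reflection s) e) (reflection-involutive s l))

    cycAdj-reflection : ∀ s k l → cycAdj (reflection s k) (reflection s l) ≡ cycAdj k l
    cycAdj-reflection s k l = ⇔→≡ (mk⇔
      (λ adj → Equivalence.from (cycAdj⇔neighbour k l) (swap-sides (Equivalence.to (cycAdj⇔neighbour (ρ k) (ρ l)) adj)))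
      (λ adj → Equivalence.from (cycAdj⇔neighbour (ρ k) (ρ l)) (reflect-sides (Equivalence.to (cycAdj⇔neighbour k l) adj))))
      where
      ρ = reflection s
      swap-sides : ρ l ≡ next (ρ k) ⊎ ρ l ≡ prev (ρ k) → l ≡ next k ⊎ l ≡ prev k
      swap-sides (inj₁ e) = inj₂ (reflection-injective s (trans e (sym (reflection-prev s k))))
      swap-sides (inj₂ e) = inj₁ (reflection-injective s (trans e (sym (reflection-next s k))))
      reflect-sides : l ≡ next k ⊎ l ≡ prev k → ρ l ≡ next (ρ k) ⊎ ρ l ≡ prev (ρ k)
      reflect-sides (inj₁ e) = inj₂ (trans (cong ρ e) (reflection-next s k))
      reflect-sides (inj₂ e) = inj₁ (trans (cong ρ e) (reflection-prev s k))

-- Graphs on the two clusters through integer matrices indexed by vertices: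
-- adjacency, degrees, signless Laplacians and conjugation by
-- W = I + P + Σ - PΣ for commuting involutions P, Σ.
module Graphs where

  open import Defs
  open FiniteSums
  open Determinants using (_·_; _ᵀ; det-exchangedBySandwich)
  open CyclicOrder using (b2z; ¬-true)
  open import Data.Nat as ℕ using (ℕ; zero; suc)
  open import Data.Fin as Fin using (Fin; join; splitAt)
  open import Data.Fin.Properties using (splitAt-join; join-splitAt)
  open import Data.Integer using (ℤ; +_; -_; _+_; _*_; _-_; 0ℤ; 1ℤ)
  open import Data.Integer.Properties using (*-identityˡ; *-identityʳ; +-assoc; +-identityˡ; *-comm; +-injective; *-distribˡ-+)
  open import Data.Integer.Solver using (module +-*-Solver)
  open +-*-Solver
  open import Data.Bool using (Bool; true; false; _∨_; _∧_; if_then_else_)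
  open import Data.Bool.Properties using (∨-identityʳ; ∧-zeroʳ)
  open import Data.Sum using (_⊎_; inj₁; inj₂)
  import Data.Sum as Sum
  open import Data.Sum.Properties using (≡-dec)
  open import Data.Product using (_,_; _×_; proj₁)
  open import Function using (_∘_; Inverse; mk⇔)
  open import Relation.Nullary using (Dec; yes; no; does; contradiction)
  open import Relation.Nullary.Decidable using (does-⇔; dec-false)
  open import Relation.Binary.PropositionalEquality
  open ≡-Reasoning

  module _ {q : ℕ} where

    private
      V = Vertex q

    _≟V_ : (x y : V) → Dec (x ≡ y)
    _≟V_ = ≡-dec Fin._≟_ Fin._≟_

    δV : V → V → ℤ
    δV x y = ind (x ≟V y)

    X : V → V → ℤ
    X u x = δV x u

    adj : Graph q → V → V → ℤ
    adj G x y = b2z (G x y)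

    δV-refl : ∀ x → δV x x ≡ 1ℤ
    δV-refl x = ind-yes (x ≟V x) refl

    δV-≢ : ∀ {x y} → x ≢ y → δV x y ≡ 0ℤ
    δV-≢ {x} {y} = ind-no (x ≟V y)

    δV-subst : ∀ (f : V → ℤ) x y → δV x y * f x ≡ δV x y * f y
    δV-subst f x y with x ≟V y
    ... | yes refl = refl
    ... | no _ = refl

    δV-indicator : ∀ x y u → δV x y * X u x ≡ X u x * X u y
    δV-indicator x y u = begin
      δV x y * δV x u    ≡⟨ δV-subst (λ z → δV z u) x y ⟩
      δV x y * δV y u    ≡⟨ *-comm (δV x y) (δV y u) ⟩
      δV y u * δV x y    ≡⟨ δV-subst (δV x) y u ⟩
      δV y u * δV x u    ≡⟨ *-comm (δV y u) (δV x u) ⟩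
      δV x u * δV y u ∎

    δV-involution : ∀ (g : V → V) → (∀ v → g (g v) ≡ v) → ∀ x y → δV (g x) y ≡ δV x (g y)
    δV-involution g gg x y with g x ≟V y | x ≟V g y
    ... | yes _ | yes _ = refl
    ... | no _ | no _ = refl
    ... | yes gx≡y | no x≢gy = contradiction (trans (sym (gg x)) (cong g gx≡y)) x≢gy
    ... | no gx≢y | yes x≡gy = contradiction (trans (cong g x≡gy) (gg y)) gx≢y

    vsum : (V → ℤ) → ℤ
    vsum f = sumℤ (q ℕ.+ q) (f ∘ vtx)

    vsum-cong : ∀ {f g : V → ℤ} → (∀ w → f w ≡ g w) → vsum f ≡ vsum g
    vsum-cong e = sum-cong (q ℕ.+ q) (e ∘ vtx)

    vsum-+ : ∀ f g → vsum (λ w → f w + g w) ≡ vsum f + vsum g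
    vsum-+ f g = sum-+ (q ℕ.+ q) (f ∘ vtx) (g ∘ vtx)

    vsum-* : ∀ c f → vsum (λ w → c * f w) ≡ c * vsum f
    vsum-* c f = sum-* (q ℕ.+ q) c (f ∘ vtx)

    vsum-clusters : ∀ f → vsum f ≡ sumℤ q (f ∘ inj₁) + sumℤ q (f ∘ inj₂)
    vsum-clusters = split q
      where
      split : ∀ m (f : Fin m ⊎ Fin q → ℤ) → sumℤ (m ℕ.+ q) (f ∘ splitAt m) ≡ sumℤ m (f ∘ inj₁) + sumℤ q (f ∘ inj₂)
      split zero f = sym (+-identityˡ _)
      split (suc m) f = trans (cong (_+_ (f (inj₁ Fin.zero))) (split m (f ∘ Sum.map₁ Fin.suc)))
                              (sym (+-assoc (f (inj₁ Fin.zero)) (sumℤ m (f ∘ inj₁ ∘ Fin.suc)) _))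

    vsum-indicator : ∀ u → vsum (X u) ≡ 1ℤ
    vsum-indicator (inj₁ c) = trans (vsum-clusters (X (inj₁ c))) (cong₂ _+_ (sum-indicator q c) (sum-zero q _ (λ _ → refl)))
    vsum-indicator (inj₂ c) = trans (vsum-clusters (X (inj₂ c))) (cong₂ _+_ (sum-zero q _ (λ _ → refl)) (sum-indicator q c))

    degree-adj : ∀ G x → + degree G x ≡ vsum (adj G x)
    degree-adj G x = trans (sumℕ-to-ℤ (q ℕ.+ q) (λ k → if G x (vtx k) then 1 else 0))
                           (sum-cong (q ℕ.+ q) (λ k → 0/1 (G x (vtx k))))
      where
      0/1 : ∀ b → + (if b then 1 else 0) ≡ b2z b
      0/1 false = refl
      0/1 true = refl

    onIndex : (V → V) → Fin (q ℕ.+ q) → Fin (q ℕ.+ q)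
    onIndex g a = join q q (g (vtx a))

    vtx-onIndex : ∀ g a → vtx {q} (onIndex g a) ≡ g (vtx a)
    vtx-onIndex g a = splitAt-join q q (g (vtx a))

    onIndex-inverse : ∀ {g g′ : V → V} → (∀ x → g′ (g x) ≡ x) → ∀ a → onIndex g′ (onIndex g a) ≡ a
    onIndex-inverse {g} {g′} g′g a = begin
      join q q (g′ (vtx (onIndex g a)))   ≡⟨ cong (join q q ∘ g′) (vtx-onIndex g a) ⟩
      join q q (g′ (g (vtx a)))           ≡⟨ cong (join q q) (g′g (vtx a)) ⟩
      join q q (vtx a)                    ≡⟨ join-splitAt q q a ⟩
      a ∎

    vsum-bijection : ∀ (f : V → V) (f⁻¹ : V → V) → (∀ y → f (f⁻¹ y) ≡ y) → (∀ x → f⁻¹ (f x) ≡ x) →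
      ∀ h → vsum (h ∘ f) ≡ vsum h
    vsum-bijection f f⁻¹ ff⁻¹ f⁻¹f h = begin
      vsum (h ∘ f)
        ≡⟨ sum-cong (q ℕ.+ q) (λ a → cong h (sym (vtx-onIndex f a))) ⟩
      sumℤ (q ℕ.+ q) (h ∘ vtx ∘ onIndex f)
        ≡⟨ sum-permute (q ℕ.+ q) (onIndex f) (onIndex f⁻¹) (onIndex-inverse {f} {f⁻¹} f⁻¹f) (onIndex-inverse {f⁻¹} {f} ff⁻¹) (h ∘ vtx) ⟩
      vsum h ∎

    degree-isomorphism : ∀ G H (iso : Isomorphic q G H) x → degree G x ≡ degree H (Inverse.to (proj₁ iso) x)
    degree-isomorphism G H (f , preserves) x = +-injective (begin
      + degree G x                        ≡⟨ degree-adj G x ⟩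
      vsum (adj G x)                      ≡⟨ vsum-cong (λ y → cong b2z (preserves x y)) ⟩
      vsum (adj H (to x) ∘ to)            ≡⟨ vsum-bijection to from strictlyInverseˡ strictlyInverseʳ (adj H (to x)) ⟩
      vsum (adj H (to x))                 ≡⟨ degree-adj H (to x) ⟨
      + degree H (to x) ∎)
      where open Inverse f

    signless : (V → V → ℤ) → V → V → ℤ
    signless A x y = δV x y * vsum (A x) + A x y

    signless-+ : ∀ A B x y → signless (λ u w → A u w + B u w) x y ≡ signless A x y + signless B x y
    signless-+ A B x y = begin
      δV x y * vsum (λ w → A x w + B x w) + (A x y + B x y)
        ≡⟨ cong (λ s → δV x y * s + (A x y + B x y)) (vsum-+ (A x) (B x)) ⟩
      δV x y * (vsum (A x) + vsum (B x)) + (A x y + B x y)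
        ≡⟨ solve 5 (λ d a b c e → d :* (a :+ b) :+ (c :+ e) := (d :* a :+ c) :+ (d :* b :+ e)) refl
             (δV x y) (vsum (A x)) (vsum (B x)) (A x y) (B x y) ⟩
      signless A x y + signless B x y ∎

    charVertex : Graph q → ℤ → V → V → ℤ
    charVertex G t x y = δV x y * t - signless (adj G) x y

    charMatrix-vertices : ∀ G t a b → δ a b t - Qmat G a b ≡ charVertex G t (vtx a) (vtx b)
    charMatrix-vertices G t a b = begin
      δ a b t - (δ a b (+ degree G (vtx a)) + adj G (vtx a) (vtx b))
        ≡⟨ entry (does (a Fin.≟ b)) t (+ degree G (vtx a)) (adj G (vtx a) (vtx b)) ⟩
      b2z (does (a Fin.≟ b)) * t - (b2z (does (a Fin.≟ b)) * + degree G (vtx a) + adj G (vtx a) (vtx b))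
        ≡⟨ cong₂ (λ e d → b2z e * t - (b2z e * d + adj G (vtx a) (vtx b))) same-test (degree-adj G (vtx a)) ⟩
      δV (vtx a) (vtx b) * t - signless (adj G) (vtx a) (vtx b) ∎
      where
      entry : ∀ e t D A → (if e then t else 0ℤ) - ((if e then D else 0ℤ) + A) ≡ b2z e * t - (b2z e * D + A)
      entry false t D A = refl
      entry true t D A = solve 3 (λ t d a → t :- (d :+ a) := con 1ℤ :* t :- (con 1ℤ :* d :+ a)) refl t D A
      same-test : does (a Fin.≟ b) ≡ does (vtx a ≟V vtx b)
      same-test = does-⇔ (mk⇔ (cong vtx) (λ e → trans (sym (join-splitAt q q a)) (trans (cong (join q q) e) (join-splitAt q q b))))
                         (a Fin.≟ b) (vtx a ≟V vtx b)

    edgeAdj : V → V → V → V → ℤ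
    edgeAdj u w x y = X u x * X w y + X w x * X u y

    edgeQ : V → V → V → V → ℤ
    edgeQ u w x y = (X u x + X w x) * (X u y + X w y)

    vsum-edgeAdj : ∀ u w x → vsum (edgeAdj u w x) ≡ X u x + X w x
    vsum-edgeAdj u w x = begin
      vsum (edgeAdj u w x)                        ≡⟨ vsum-+ (λ y → X u x * X w y) (λ y → X w x * X u y) ⟩
      vsum (λ y → X u x * X w y) + vsum (λ y → X w x * X u y)
                                                  ≡⟨ cong₂ _+_ (vsum-* (X u x) (X w)) (vsum-* (X w x) (X u)) ⟩
      X u x * vsum (X w) + X w x * vsum (X u)     ≡⟨ cong₂ (λ s t → X u x * s + X w x * t) (vsum-indicator w) (vsum-indicator u) ⟩
      X u x * 1ℤ + X w x * 1ℤ                     ≡⟨ cong₂ _+_ (*-identityʳ (X u x)) (*-identityʳ (X w x)) ⟩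
      X u x + X w x ∎

    signless-edge : ∀ u w x y → signless (edgeAdj u w) x y ≡ edgeQ u w x y
    signless-edge u w x y = begin
      δV x y * vsum (edgeAdj u w x) + edgeAdj u w x y
        ≡⟨ cong (λ s → δV x y * s + edgeAdj u w x y) (vsum-edgeAdj u w x) ⟩
      δV x y * (X u x + X w x) + edgeAdj u w x y
        ≡⟨ cong (_+ edgeAdj u w x y) (trans (*-distribˡ-+ (δV x y) (X u x) (X w x))
                                            (cong₂ _+_ (δV-indicator x y u) (δV-indicator x y w))) ⟩
      (X u x * X u y + X w x * X w y) + edgeAdj u w x y
        ≡⟨ solve 4 (λ a b c d → (a :* c :+ b :* d) :+ (a :* d :+ b :* c) := (a :+ b) :* (c :+ d)) refl
             (X u x) (X w x) (X u y) (X w y) ⟩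
      edgeQ u w x y ∎

    signless-threeEdges : ∀ (A B : V → V → ℤ) u₁ w₁ u₂ w₂ u₃ w₃ →
      (∀ x y → A x y ≡ B x y + edgeAdj u₁ w₁ x y + edgeAdj u₂ w₂ x y + edgeAdj u₃ w₃ x y) →
      ∀ x y → signless A x y ≡ signless B x y + edgeQ u₁ w₁ x y + edgeQ u₂ w₂ x y + edgeQ u₃ w₃ x y
    signless-threeEdges A B u₁ w₁ u₂ w₂ u₃ w₃ A≡ x y = begin
      δV x y * vsum (A x) + A x y
        ≡⟨ cong₂ (λ s t → δV x y * s + t) (vsum-cong (A≡ x)) (A≡ x y) ⟩
      signless (λ u w → B u w + e₁ u w + e₂ u w + e₃ u w) x y
        ≡⟨ signless-+ (λ u w → B u w + e₁ u w + e₂ u w) e₃ x y ⟩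
      signless (λ u w → B u w + e₁ u w + e₂ u w) x y + signless e₃ x y
        ≡⟨ cong (_+ signless e₃ x y) (signless-+ (λ u w → B u w + e₁ u w) e₂ x y) ⟩
      signless (λ u w → B u w + e₁ u w) x y + signless e₂ x y + signless e₃ x y
        ≡⟨ cong (λ s → s + signless e₂ x y + signless e₃ x y) (signless-+ B e₁ x y) ⟩
      signless B x y + signless e₁ x y + signless e₂ x y + signless e₃ x y
        ≡⟨ cong₂ _+_ (cong₂ _+_ (cong (_+_ (signless B x y)) (signless-edge u₁ w₁ x y)) (signless-edge u₂ w₂ x y)) (signless-edge u₃ w₃ x y) ⟩
      signless B x y + edgeQ u₁ w₁ x y + edgeQ u₂ w₂ x y + edgeQ u₃ w₃ x y ∎
      where
      e₁ = edgeAdj u₁ w₁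
      e₂ = edgeAdj u₂ w₂
      e₃ = edgeAdj u₃ w₃

    adj-addEdge : ∀ H u w → u ≢ w → H u w ≡ false → H w u ≡ false →
      ∀ x y → adj (addEdge u w H) x y ≡ adj H x y + edgeAdj u w x y
    adj-addEdge H u w u≢w Huw Hwu x y = trans
      (b2z-exclusive-∨ (H x y) (eqV x u ∧ eqV y w) (eqV x w ∧ eqV y u) not-in-H-uw not-in-H-wu distinct-ends)
      (trans (cong₂ (λ s t → adj H x y + s + t) (b2z-∧ (eqV x u) (eqV y w)) (b2z-∧ (eqV x w) (eqV y u)))
             (+-assoc (adj H x y) _ _))
      where
      b2z-∧ : ∀ a b → b2z (a ∧ b) ≡ b2z a * b2z b
      b2z-∧ false b = refl
      b2z-∧ true b = sym (*-identityˡ (b2z b))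
      b2z-exclusive-∨ : ∀ a b c → (b ≡ true → a ≡ false) → (c ≡ true → a ≡ false) → (b ≡ true → c ≡ false) →
        b2z (a ∨ b ∨ c) ≡ b2z a + b2z b + b2z c
      b2z-exclusive-∨ false false false _ _ _ = refl
      b2z-exclusive-∨ false false true _ _ _ = refl
      b2z-exclusive-∨ false true false _ _ _ = refl
      b2z-exclusive-∨ false true true _ _ bc = contradiction (bc refl) λ ()
      b2z-exclusive-∨ true false false _ _ _ = refl
      b2z-exclusive-∨ true false true _ ca _ = contradiction (ca refl) λ ()
      b2z-exclusive-∨ true true c ba _ _ = contradiction (ba refl) λ ()
      ends : ∀ {s t} → eqV x s ∧ eqV y t ≡ true → x ≡ s × y ≡ t
      ends {s} {t} e with x ≟V s | y ≟V t
      ... | yes x≡s | yes y≡t = x≡s , y≡t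
      not-in-H-uw : eqV x u ∧ eqV y w ≡ true → H x y ≡ false
      not-in-H-uw e with ends e
      ... | refl , refl = Huw
      not-in-H-wu : eqV x w ∧ eqV y u ≡ true → H x y ≡ false
      not-in-H-wu e with ends e
      ... | refl , refl = Hwu
      distinct-ends : eqV x u ∧ eqV y w ≡ true → eqV x w ∧ eqV y u ≡ false
      distinct-ends e = ¬-true λ e′ → u≢w (trans (sym (proj₁ (ends e))) (proj₁ (ends e′)))

    addEdge-other : ∀ u w H x y → (x ≢ u ⊎ y ≢ w) → (x ≢ w ⊎ y ≢ u) → addEdge u w H x y ≡ H x y
    addEdge-other u w H x y xy≢uw xy≢wu =
      trans (cong₂ (λ s t → H x y ∨ s ∨ t) (not-both xy≢uw) (not-both xy≢wu)) (∨-identityʳ (H x y))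
      where
      not-both : ∀ {s t} → x ≢ s ⊎ y ≢ t → eqV x s ∧ eqV y t ≡ false
      not-both {s} (inj₁ x≢s) = cong (_∧ _) (dec-false (x ≟V s) x≢s)
      not-both {s} {t} (inj₂ y≢t) = trans (cong (eqV x s ∧_) (dec-false (y ≟V t) y≢t)) (∧-zeroʳ (eqV x s))

    -- Conjugation by W = I + P + Σ - PΣ for two commuting involutions P, Σ of
    -- the vertices.  T is W acting on vertex functions, S is F ↦ W F Wᵀ.
    module Sandwich (P Σ : V → V) (P-invol : ∀ v → P (P v) ≡ v) (Σ-invol : ∀ v → Σ (Σ v) ≡ v)
                    (commute : ∀ v → P (Σ v) ≡ Σ (P v)) where

      T : (V → ℤ) → V → ℤ
      T f x = f x + f (P x) + f (Σ x) - f (P (Σ x))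

      S : (V → V → ℤ) → V → V → ℤ
      S F x y = T (λ u → T (F u) y) x

      T-cong : ∀ {f g} x → (∀ u → f u ≡ g u) → T f x ≡ T g x
      T-cong x e = cong₂ _-_ (cong₂ _+_ (cong₂ _+_ (e x) (e (P x))) (e (Σ x))) (e (P (Σ x)))

      S-cong : ∀ {F G} x y → (∀ u w → F u w ≡ G u w) → S F x y ≡ S G x y
      S-cong x y e = T-cong x (λ u → T-cong y (e u))

      T-- : ∀ (f g : V → ℤ) x → T (λ u → f u - g u) x ≡ T f x - T g x
      T-- f g x = solve 8 (λ a b c d a′ b′ c′ d′ →
          (a :- a′) :+ (b :- b′) :+ (c :- c′) :- (d :- d′) := (a :+ b :+ c :- d) :- (a′ :+ b′ :+ c′ :- d′)) refl
        (f x) (f (P x)) (f (Σ x)) (f (P (Σ x))) (g x) (g (P x)) (g (Σ x)) (g (P (Σ x)))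

      S-- : ∀ (F G : V → V → ℤ) x y → S (λ u w → F u w - G u w) x y ≡ S F x y - S G x y
      S-- F G x y = trans (T-cong x (λ u → T-- (F u) (G u) y)) (T-- (λ u → T (F u) y) (λ u → T (G u) y) x)

      T-+ : ∀ (f g : V → ℤ) x → T (λ u → f u + g u) x ≡ T f x + T g x
      T-+ f g x = solve 8 (λ a b c d a′ b′ c′ d′ →
          (a :+ a′) :+ (b :+ b′) :+ (c :+ c′) :- (d :+ d′) := (a :+ b :+ c :- d) :+ (a′ :+ b′ :+ c′ :- d′)) refl
        (f x) (f (P x)) (f (Σ x)) (f (P (Σ x))) (g x) (g (P x)) (g (Σ x)) (g (P (Σ x)))

      T-scale : ∀ c (f : V → ℤ) x → T (λ u → c * f u) x ≡ c * T f x
      T-scale c f x = solve 5 (λ c a b d e → c :* a :+ c :* b :+ c :* d :- c :* e := c :* (a :+ b :+ d :- e)) refl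
        c (f x) (f (P x)) (f (Σ x)) (f (P (Σ x)))

      S-outer : ∀ (f g : V → ℤ) x y → S (λ u w → f u * g w) x y ≡ T f x * T g y
      S-outer f g x y = begin
        T (λ u → T (λ w → f u * g w) y) x    ≡⟨ T-cong x (λ u → trans (T-scale (f u) g y) (*-comm (f u) (T g y))) ⟩
        T (λ u → T g y * f u) x              ≡⟨ T-scale (T g y) f x ⟩
        T g y * T f x                        ≡⟨ *-comm (T g y) (T f x) ⟩
        T f x * T g y ∎

      S-invariant : ∀ (F : V → V → ℤ) → (∀ u w → F (P u) (P w) ≡ F u w) → (∀ u w → F (Σ u) (Σ w) ≡ F u w) →
        ∀ x y → S F x y ≡ + 4 * F x y
      S-invariant F F-P F-Σ x y = begin
        T (λ u → T (F u) y) x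
          ≡⟨⟩
        (a + b + c - d) + T (F (P x)) y + T (F (Σ x)) y - T (F (P (Σ x))) y
          ≡⟨ cong₂ (λ s t → (a + b + c - d) + s + t - T (F (P (Σ x))) y) row-P row-Σ ⟩
        (a + b + c - d) + (b + a + d - c) + (c + d + a - b) - T (F (P (Σ x))) y
          ≡⟨ cong (_-_ ((a + b + c - d) + (b + a + d - c) + (c + d + a - b))) row-PΣ ⟩
        (a + b + c - d) + (b + a + d - c) + (c + d + a - b) - (d + c + b - a)
          ≡⟨ solve 4 (λ a b c d → (a :+ b :+ c :- d) :+ (b :+ a :+ d :- c) :+ (c :+ d :+ a :- b) :- (d :+ c :+ b :- a)
                                  := con (+ 4) :* a) refl a b c d ⟩
        + 4 * F x y ∎
        where
        a = F x y
        b = F x (P y)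
        c = F x (Σ y)
        d = F x (P (Σ y))
        F-PΣ : ∀ u w → F (P (Σ u)) (P (Σ w)) ≡ F u w
        F-PΣ u w = trans (F-P (Σ u) (Σ w)) (F-Σ u w)
        shift : ∀ (g : V → V) → (∀ v → g (g v) ≡ v) → (∀ u w → F (g u) (g w) ≡ F u w) → ∀ w → F (g x) w ≡ F x (g w)
        shift g gg F-g w = trans (cong (F (g x)) (sym (gg w))) (F-g x (g w))
        PΣ-invol : ∀ v → P (Σ (P (Σ v))) ≡ v
        PΣ-invol v = trans (cong (P ∘ Σ) (commute v)) (trans (cong P (Σ-invol (P v))) (P-invol v))
        row-P : T (F (P x)) y ≡ b + a + d - c
        row-P = trans (T-cong y (shift P P-invol F-P))
          (cong₂ (λ s t → F x (P y) + F x s + d - F x t) (P-invol y) (P-invol (Σ y)))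
        row-Σ : T (F (Σ x)) y ≡ c + d + a - b
        row-Σ = trans (T-cong y (shift Σ Σ-invol F-Σ))
          (trans (cong₂ (λ s t → F x (Σ y) + F x s + F x (Σ (Σ y)) - F x t) (sym (commute y))
                        (trans (cong Σ (commute y)) (Σ-invol (P y))))
                 (cong (λ s → c + d + F x s - b) (Σ-invol y)))
        row-PΣ : T (F (P (Σ x))) y ≡ d + c + b - a
        row-PΣ = trans (T-cong y (shift (P ∘ Σ) PΣ-invol F-PΣ))
          (trans (cong₂ (λ s t → F x (P (Σ y)) + F x s + F x t - F x (P (Σ (P (Σ y)))))
                        (trans (cong P (sym (commute y))) (P-invol (Σ y))) (cong P (Σ-invol y)))
                 (cong (λ s → d + c + b - F x s) (PΣ-invol y)))

      S-edge : ∀ u w u′ w′ → (∀ x → T (X u) x + T (X w) x ≡ + 2 * (X u′ x + X w′ x)) →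
        ∀ x y → S (edgeQ u w) x y ≡ + 4 * edgeQ u′ w′ x y
      S-edge u w u′ w′ T-edge x y = begin
        S (λ a b → (X u a + X w a) * (X u b + X w b)) x y
          ≡⟨ S-outer (λ a → X u a + X w a) (λ b → X u b + X w b) x y ⟩
        T (λ a → X u a + X w a) x * T (λ b → X u b + X w b) y
          ≡⟨ cong₂ _*_ (trans (T-+ (X u) (X w) x) (T-edge x)) (trans (T-+ (X u) (X w) y) (T-edge y)) ⟩
        (+ 2 * (X u′ x + X w′ x)) * (+ 2 * (X u′ y + X w′ y))
          ≡⟨ solve 2 (λ a b → (con (+ 2) :* a) :* (con (+ 2) :* b) := con (+ 4) :* (a :* b)) refl (X u′ x + X w′ x) (X u′ y + X w′ y) ⟩
        + 4 * edgeQ u′ w′ x y ∎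

      T-indicator : ∀ u x → T (X u) x ≡ X u x + X (P u) x + X (Σ u) x - X (P (Σ u)) x
      T-indicator u x = cong₂ _-_ (cong₂ _+_ (cong (_+_ (X u x)) (δV-involution P P-invol x u)) (δV-involution Σ Σ-invol x u))
                                  (δV-involution (P ∘ Σ) PΣ-invol x u)
        where
        PΣ-invol : ∀ v → P (Σ (P (Σ v))) ≡ v
        PΣ-invol v = trans (cong (P ∘ Σ) (commute v)) (trans (cong P (Σ-invol (P v))) (P-invol v))

      W : Matrix (q ℕ.+ q)
      W a b = ind (b Fin.≟ a) + ind (b Fin.≟ onIndex P a) + ind (b Fin.≟ onIndex Σ a) - ind (b Fin.≟ onIndex (P ∘ Σ) a)

      W-row : ∀ a (f : Fin (q ℕ.+ q) → ℤ) → sumℤ (q ℕ.+ q) (λ b → W a b * f b) ≡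
        f a + f (onIndex P a) + f (onIndex Σ a) - f (onIndex (P ∘ Σ) a)
      W-row a f = begin
        sumℤ n (λ b → (δ₁ b + δ₂ b + δ₃ b - δ₄ b) * f b)
          ≡⟨ sum-cong n (λ b → solve 5 (λ p₁ p₂ p₃ p₄ x → (p₁ :+ p₂ :+ p₃ :- p₄) :* x := p₁ :* x :+ p₂ :* x :+ p₃ :* x :+ (:- (p₄ :* x))) refl
                                  (δ₁ b) (δ₂ b) (δ₃ b) (δ₄ b) (f b)) ⟩
        sumℤ n (λ b → δ₁ b * f b + δ₂ b * f b + δ₃ b * f b + - (δ₄ b * f b))
          ≡⟨ sum-+ n (λ b → δ₁ b * f b + δ₂ b * f b + δ₃ b * f b) (λ b → - (δ₄ b * f b)) ⟩
        sumℤ n (λ b → δ₁ b * f b + δ₂ b * f b + δ₃ b * f b) + sumℤ n (λ b → - (δ₄ b * f b))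
          ≡⟨ cong₂ _+_ (trans (sum-+ n (λ b → δ₁ b * f b + δ₂ b * f b) (λ b → δ₃ b * f b))
                              (cong₂ _+_ (trans (sum-+ n (λ b → δ₁ b * f b) (λ b → δ₂ b * f b))
                                                (cong₂ _+_ (sum-delta n a f) (sum-delta n (onIndex P a) f)))
                                         (sum-delta n (onIndex Σ a) f)))
                       (trans (sum-neg n (λ b → δ₄ b * f b)) (cong -_ (sum-delta n (onIndex (P ∘ Σ) a) f))) ⟩
        f a + f (onIndex P a) + f (onIndex Σ a) - f (onIndex (P ∘ Σ) a) ∎
        where
        n = q ℕ.+ q
        δ₁ δ₂ δ₃ δ₄ : Fin n → ℤ
        δ₁ b = ind (b Fin.≟ a)
        δ₂ b = ind (b Fin.≟ onIndex P a)
        δ₃ b = ind (b Fin.≟ onIndex Σ a)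
        δ₄ b = ind (b Fin.≟ onIndex (P ∘ Σ) a)

      W-sandwich : ∀ (M : Matrix (q ℕ.+ q)) (F : V → V → ℤ) → (∀ a b → M a b ≡ F (vtx a) (vtx b)) →
        ∀ a c → (W · (M · (W ᵀ))) a c ≡ S F (vtx a) (vtx c)
      W-sandwich M F M≡F a c = begin
        (W · (M · (W ᵀ))) a c
          ≡⟨ W-row a (λ b → (M · (W ᵀ)) b c) ⟩
        Y a + Y (onIndex P a) + Y (onIndex Σ a) - Y (onIndex (P ∘ Σ) a)
          ≡⟨ cong₂ _-_ (cong₂ _+_ (cong₂ _+_ (Y≡ a) (moved P a)) (moved Σ a)) (moved (P ∘ Σ) a) ⟩
        S F (vtx a) (vtx c) ∎
        where
        Y : Fin (q ℕ.+ q) → ℤ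
        Y b = (M · (W ᵀ)) b c
        Y≡ : ∀ b → Y b ≡ T (F (vtx b)) (vtx c)
        Y≡ b = trans (sum-cong (q ℕ.+ q) (λ d → *-comm (M b d) (W c d)))
          (trans (W-row c (M b))
            (cong₂ _-_ (cong₂ _+_ (cong₂ _+_ (M≡F b c) (entry P)) (entry Σ)) (entry (P ∘ Σ))))
          where
          entry : ∀ g → M b (onIndex g c) ≡ F (vtx b) (g (vtx c))
          entry g = trans (M≡F b (onIndex g c)) (cong (F (vtx b)) (vtx-onIndex g c))
        moved : ∀ g a → Y (onIndex g a) ≡ T (F (g (vtx a))) (vtx c)
        moved g a = trans (Y≡ (onIndex g a)) (cong (λ v → T (F v) (vtx c)) (vtx-onIndex g a))

      cospectral-by-sandwich : ∀ H H′ →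
        (∀ t x y → S (charVertex H t) x y ≡ + 4 * charVertex H′ t x y) →
        (∀ t x y → S (charVertex H′ t) x y ≡ + 4 * charVertex H t x y) →
        QCospectral q H H′
      cospectral-by-sandwich H H′ S-H S-H′ t =
        det-exchangedBySandwich (q ℕ.+ q) 4 _ _ W (exchange H H′ (S-H t)) (exchange H′ H (S-H′ t))
        where
        exchange : ∀ K K′ → (∀ x y → S (charVertex K t) x y ≡ + 4 * charVertex K′ t x y) →
          ∀ a c → (W · ((λ a b → δ a b t - Qmat K a b) · (W ᵀ))) a c ≡ + 4 * (δ a c t - Qmat K′ a c)
        exchange K K′ S-K a c = begin
          (W · ((λ a b → δ a b t - Qmat K a b) · (W ᵀ))) a c
            ≡⟨ W-sandwich (λ a b → δ a b t - Qmat K a b) (charVertex K t) (charMatrix-vertices K t) a c ⟩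
          S (charVertex K t) (vtx a) (vtx c)       ≡⟨ S-K (vtx a) (vtx c) ⟩
          + 4 * charVertex K′ t (vtx a) (vtx c)    ≡⟨ cong (_*_ (+ 4)) (charMatrix-vertices K′ t a c) ⟨
          + 4 * (δ a c t - Qmat K′ a c) ∎

-- G is a parameter, known only
-- through its defining equation: this keeps the type checker from unfolding
-- it when comparing matrices built from it.
module Construction (p : ℕ) (i j : Fin (suc (suc (suc p)))) (i≢j : i ≢ j)
                    (nonadjacent : G₀ (suc (suc (suc p))) (inj₁ i) (inj₁ j) ≡ false)
                    (G : Graph (suc (suc (suc p)))) (G-def : ∀ x y → G x y ≡ Gnew (suc (suc (suc p))) i j x y) where

  open import Defs
  open import Data.Nat as ℕ using (ℕ; suc)
  open import Data.Fin as Fin using (Fin)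
  open import Data.Sum using (inj₁; inj₂)
  open import Data.Bool using (false)
  open import Relation.Binary.PropositionalEquality
  open FiniteSums using (sum-zero)
  open CyclicOrder hiding (q)
  open Graphs
  open import Data.Integer using (ℤ; +_; -_; -[1+_]; _+_; _*_; _-_; 0ℤ; 1ℤ)
  open import Data.Integer.Properties using (*-zeroʳ; +-identityˡ; +-injective; pos-*)
  open import Data.Integer.Solver using (module +-*-Solver)
  open +-*-Solver
  open import Data.Bool.Properties using (∨-comm)
  open import Data.Product using (_,_; proj₁)
  open import Function using (Inverse)
  open import Relation.Nullary using (¬_; contradiction; yes; no)
  import Data.Nat.Properties as ℕP
  open import Data.Nat.DivMod using (m*n%n≡0)
  open ≡-Reasoning

  q : ℕ
  q = suc (suc (suc p))

  private
    V = Vertex q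

  v₁ v₂ v₃ v₄ : V
  v₁ = inj₁ i
  v₂ = inj₁ j
  v₃ = inj₂ i
  v₄ = inj₂ j

  -- The symmetries: Σ exchanges the clusters, P reflects both cycles so that
  -- i and j are exchanged.
  centre : ℤ
  centre = ⟪ p ⟫ i + ⟪ p ⟫ j

  ρ : Fin q → Fin q
  ρ = reflection p centre

  P Σ : V → V
  P (inj₁ k) = inj₁ (ρ k)
  P (inj₂ k) = inj₂ (ρ k)
  Σ (inj₁ k) = inj₂ k
  Σ (inj₂ k) = inj₁ k

  ρ-i : ρ i ≡ j
  ρ-i = reflection-swaps p i j

  ρ-j : ρ j ≡ i
  ρ-j = trans (cong ρ (sym ρ-i)) (reflection-involutive p centre i)

  P-invol : ∀ v → P (P v) ≡ v
  P-invol (inj₁ k) = cong inj₁ (reflection-involutive p centre k)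
  P-invol (inj₂ k) = cong inj₂ (reflection-involutive p centre k)

  Σ-invol : ∀ v → Σ (Σ v) ≡ v
  Σ-invol (inj₁ k) = refl
  Σ-invol (inj₂ k) = refl

  P-Σ-commute : ∀ v → P (Σ v) ≡ Σ (P v)
  P-Σ-commute (inj₁ k) = refl
  P-Σ-commute (inj₂ k) = refl

  open Sandwich P Σ P-invol Σ-invol P-Σ-commute

  δV-P : ∀ u w → δV (P u) (P w) ≡ δV u w
  δV-P u w = trans (δV-involution P P-invol u (P w)) (cong (δV u) (P-invol w))

  δV-Σ : ∀ u w → δV (Σ u) (Σ w) ≡ δV u w
  δV-Σ u w = trans (δV-involution Σ Σ-invol u (Σ w)) (cong (δV u) (Σ-invol w))

  A₀ : V → V → ℤ
  A₀ = adj (G₀ q)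

  A₀-P : ∀ u w → A₀ (P u) (P w) ≡ A₀ u w
  A₀-P (inj₁ a) (inj₁ b) = cong b2z (cycAdj-reflection p centre a b)
  A₀-P (inj₁ a) (inj₂ b) = refl
  A₀-P (inj₂ a) (inj₁ b) = refl
  A₀-P (inj₂ a) (inj₂ b) = cong b2z (cycAdj-reflection p centre a b)

  A₀-Σ : ∀ u w → A₀ (Σ u) (Σ w) ≡ A₀ u w
  A₀-Σ (inj₁ a) (inj₁ b) = refl
  A₀-Σ (inj₁ a) (inj₂ b) = refl
  A₀-Σ (inj₂ a) (inj₁ b) = refl
  A₀-Σ (inj₂ a) (inj₂ b) = refl

  cycles-regular : ∀ x → vsum (A₀ x) ≡ + 2
  cycles-regular (inj₁ a) = trans (vsum-clusters (A₀ (inj₁ a))) (cong₂ _+_ (cycle-degree p a) (sum-zero q _ (λ _ → refl)))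
  cycles-regular (inj₂ a) = trans (vsum-clusters (A₀ (inj₂ a))) (cong₂ _+_ (sum-zero q _ (λ _ → refl)) (cycle-degree p a))

  signless-cycles : ∀ x y → signless A₀ x y ≡ δV x y * + 2 + A₀ x y
  signless-cycles x y = cong (λ d → δV x y * d + A₀ x y) (cycles-regular x)

  adj-G : ∀ x y → adj G x y ≡ A₀ x y + edgeAdj v₁ v₂ x y + edgeAdj v₁ v₃ x y + edgeAdj v₁ v₄ x y
  adj-G x y = begin
    adj G x y
      ≡⟨ cong b2z (G-def x y) ⟩
    adj (Gnew q i j) x y
      ≡⟨ adj-addEdge H₂ v₁ v₄ (λ ()) H₂-v₁v₄ H₂-v₄v₁ x y ⟩
    adj H₂ x y + edgeAdj v₁ v₄ x y
      ≡⟨ cong (_+ edgeAdj v₁ v₄ x y) (adj-addEdge H₁ v₁ v₃ (λ ()) H₁-v₁v₃ refl x y) ⟩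
    adj H₁ x y + edgeAdj v₁ v₃ x y + edgeAdj v₁ v₄ x y
      ≡⟨ cong (λ a → a + edgeAdj v₁ v₃ x y + edgeAdj v₁ v₄ x y) (adj-addEdge (G₀ q) v₁ v₂ v₁≢v₂ nonadjacent nonadjacent′ x y) ⟩
    A₀ x y + edgeAdj v₁ v₂ x y + edgeAdj v₁ v₃ x y + edgeAdj v₁ v₄ x y ∎
    where
    H₁ H₂ : Graph q
    H₁ = addEdge v₁ v₂ (G₀ q)
    H₂ = addEdge v₁ v₃ H₁
    v₁≢v₂ : v₁ ≢ v₂
    v₁≢v₂ refl = i≢j refl
    v₄≢v₃ : v₄ ≢ v₃
    v₄≢v₃ refl = i≢j refl
    nonadjacent′ : G₀ q v₂ v₁ ≡ false
    nonadjacent′ = trans (∨-comm (succAdj j i) (succAdj i j)) nonadjacent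
    H₁-v₁v₃ : H₁ v₁ v₃ ≡ false
    H₁-v₁v₃ = addEdge-other v₁ v₂ (G₀ q) v₁ v₃ (inj₂ λ ()) (inj₂ λ ())
    H₂-v₁v₄ : H₂ v₁ v₄ ≡ false
    H₂-v₁v₄ = trans (addEdge-other v₁ v₃ H₁ v₁ v₄ (inj₂ v₄≢v₃) (inj₁ λ ()))
                    (addEdge-other v₁ v₂ (G₀ q) v₁ v₄ (inj₂ λ ()) (inj₂ λ ()))
    H₂-v₄v₁ : H₂ v₄ v₁ ≡ false
    H₂-v₄v₁ = trans (addEdge-other v₁ v₃ H₁ v₄ v₁ (inj₁ λ ()) (inj₁ v₄≢v₃))
                    (addEdge-other v₁ v₂ (G₀ q) v₄ v₁ (inj₁ λ ()) (inj₁ λ ()))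

  adj-Gᵗ : ∀ x y → adj (partialTranspose G) x y ≡ A₀ x y + edgeAdj v₁ v₂ x y + edgeAdj v₁ v₃ x y + edgeAdj v₂ v₃ x y
  adj-Gᵗ (inj₁ a) (inj₁ b) = trans (adj-G (inj₁ a) (inj₁ b))
    (cong (_+_ (A₀ (inj₁ a) (inj₁ b) + edgeAdj v₁ v₂ (inj₁ a) (inj₁ b) + edgeAdj v₁ v₃ (inj₁ a) (inj₁ b)))
          (trans (vanishing (X v₁ (inj₁ a)) (X v₁ (inj₁ b))) (sym (vanishing (X v₂ (inj₁ a)) (X v₂ (inj₁ b))))))
    where
    vanishing : ∀ s t → s * 0ℤ + 0ℤ * t ≡ 0ℤ
    vanishing s t = cong (_+ 0ℤ) (*-zeroʳ s)
  adj-Gᵗ (inj₂ a) (inj₂ b) = trans (adj-G (inj₂ a) (inj₂ b))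
    (cong (_+_ (A₀ (inj₂ a) (inj₂ b) + edgeAdj v₁ v₂ (inj₂ a) (inj₂ b) + edgeAdj v₁ v₃ (inj₂ a) (inj₂ b)))
          (trans (vanishing (X v₄ (inj₂ b)) (X v₄ (inj₂ a))) (sym (vanishing (X v₃ (inj₂ b)) (X v₃ (inj₂ a))))))
    where
    vanishing : ∀ s t → 0ℤ * s + t * 0ℤ ≡ 0ℤ
    vanishing s t = trans (+-identityˡ (t * 0ℤ)) (*-zeroʳ t)
  adj-Gᵗ (inj₁ a) (inj₂ b) = cross a b
    where
    cross : ∀ a b → b2z (crossτ G a b) ≡ A₀ (inj₁ a) (inj₂ b) + edgeAdj v₁ v₂ (inj₁ a) (inj₂ b)
                                           + edgeAdj v₁ v₃ (inj₁ a) (inj₂ b) + edgeAdj v₂ v₃ (inj₁ a) (inj₂ b)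
    cross a b with a Fin.≟ b
    ... | yes refl = trans (adj-G (inj₁ a) (inj₂ a))
      (solve 2 (λ x₁ x₂ → con 0ℤ :+ (x₁ :* con 0ℤ :+ x₂ :* con 0ℤ) :+ (x₁ :* x₁ :+ con 0ℤ) :+ (x₁ :* x₂ :+ con 0ℤ)
                       := con 0ℤ :+ (x₁ :* con 0ℤ :+ x₂ :* con 0ℤ) :+ (x₁ :* x₁ :+ con 0ℤ) :+ (x₂ :* x₁ :+ con 0ℤ)) refl
        (X v₁ (inj₁ a)) (X v₂ (inj₁ a)))
    ... | no _ = trans (adj-G (inj₁ b) (inj₂ a))
      (solve 4 (λ x₁ x₂ c d → con 0ℤ :+ (c :* con 0ℤ :+ d :* con 0ℤ) :+ (c :* x₁ :+ con 0ℤ) :+ (c :* x₂ :+ con 0ℤ)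
                           := con 0ℤ :+ (x₁ :* con 0ℤ :+ x₂ :* con 0ℤ) :+ (x₁ :* c :+ con 0ℤ) :+ (x₂ :* c :+ con 0ℤ)) refl
        (X v₁ (inj₁ a)) (X v₂ (inj₁ a)) (X v₁ (inj₁ b)) (X v₂ (inj₁ b)))
  adj-Gᵗ (inj₂ b) (inj₁ a) = cross a b
    where
    cross : ∀ a b → b2z (crossτ G a b) ≡ A₀ (inj₂ b) (inj₁ a) + edgeAdj v₁ v₂ (inj₂ b) (inj₁ a)
                                           + edgeAdj v₁ v₃ (inj₂ b) (inj₁ a) + edgeAdj v₂ v₃ (inj₂ b) (inj₁ a)
    cross a b with a Fin.≟ b
    ... | yes refl = trans (adj-G (inj₁ a) (inj₂ a))
      (solve 2 (λ x₁ x₂ → con 0ℤ :+ (x₁ :* con 0ℤ :+ x₂ :* con 0ℤ) :+ (x₁ :* x₁ :+ con 0ℤ) :+ (x₁ :* x₂ :+ con 0ℤ)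
                       := con 0ℤ :+ (con 0ℤ :* x₂ :+ con 0ℤ :* x₁) :+ (con 0ℤ :+ x₁ :* x₁) :+ (con 0ℤ :+ x₁ :* x₂)) refl
        (X v₁ (inj₁ a)) (X v₂ (inj₁ a)))
    ... | no _ = trans (adj-G (inj₁ b) (inj₂ a))
      (solve 4 (λ x₁ x₂ c d → con 0ℤ :+ (c :* con 0ℤ :+ d :* con 0ℤ) :+ (c :* x₁ :+ con 0ℤ) :+ (c :* x₂ :+ con 0ℤ)
                           := con 0ℤ :+ (con 0ℤ :* x₂ :+ con 0ℤ :* x₁) :+ (con 0ℤ :+ c :* x₁) :+ (con 0ℤ :+ c :* x₂)) refl
        (X v₁ (inj₁ a)) (X v₂ (inj₁ a)) (X v₁ (inj₁ b)) (X v₂ (inj₁ b)))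

  charCycles : ℤ → V → V → ℤ
  charCycles t x y = δV x y * t - signless A₀ x y

  charVertex-G : ∀ t x y → charVertex G t x y ≡ charCycles t x y - edgeQ v₁ v₂ x y - edgeQ v₁ v₃ x y - edgeQ v₁ v₄ x y
  charVertex-G t x y = trans (cong (_-_ (δV x y * t)) (signless-threeEdges (adj G) A₀ v₁ v₂ v₁ v₃ v₁ v₄ adj-G x y))
    (solve 5 (λ d a b c e → d :- (a :+ b :+ c :+ e) := d :- a :- b :- c :- e) refl
       (δV x y * t) (signless A₀ x y) (edgeQ v₁ v₂ x y) (edgeQ v₁ v₃ x y) (edgeQ v₁ v₄ x y))

  charVertex-Gᵗ : ∀ t x y → charVertex (partialTranspose G) t x y ≡ charCycles t x y - edgeQ v₁ v₂ x y - edgeQ v₁ v₃ x y - edgeQ v₂ v₃ x y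
  charVertex-Gᵗ t x y = trans (cong (_-_ (δV x y * t)) (signless-threeEdges (adj (partialTranspose G)) A₀ v₁ v₂ v₁ v₃ v₂ v₃ adj-Gᵗ x y))
    (solve 5 (λ d a b c e → d :- (a :+ b :+ c :+ e) := d :- a :- b :- c :- e) refl
       (δV x y * t) (signless A₀ x y) (edgeQ v₁ v₂ x y) (edgeQ v₁ v₃ x y) (edgeQ v₂ v₃ x y))

  charCycles-P : ∀ t u w → charCycles t (P u) (P w) ≡ charCycles t u w
  charCycles-P t u w = trans (cong (_-_ (δV (P u) (P w) * t)) (signless-cycles (P u) (P w)))
    (trans (cong₂ (λ d a → d * t - (d * + 2 + a)) (δV-P u w) (A₀-P u w)) (sym (cong (_-_ (δV u w * t)) (signless-cycles u w))))

  charCycles-Σ : ∀ t u w → charCycles t (Σ u) (Σ w) ≡ charCycles t u w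
  charCycles-Σ t u w = trans (cong (_-_ (δV (Σ u) (Σ w) * t)) (signless-cycles (Σ u) (Σ w)))
    (trans (cong₂ (λ d a → d * t - (d * + 2 + a)) (δV-Σ u w) (A₀-Σ u w)) (sym (cong (_-_ (δV u w * t)) (signless-cycles u w))))

  T-X₁ : ∀ x → T (X v₁) x ≡ X v₁ x + X v₂ x + X v₃ x - X v₄ x
  T-X₁ x = trans (T-indicator v₁ x) (cong₂ (λ a b → X v₁ x + X a x + X v₃ x - X b x) (cong inj₁ ρ-i) (cong inj₂ ρ-i))

  T-X₂ : ∀ x → T (X v₂) x ≡ X v₂ x + X v₁ x + X v₄ x - X v₃ x
  T-X₂ x = trans (T-indicator v₂ x) (cong₂ (λ a b → X v₂ x + X a x + X v₄ x - X b x) (cong inj₁ ρ-j) (cong inj₂ ρ-j))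

  T-X₃ : ∀ x → T (X v₃) x ≡ X v₃ x + X v₄ x + X v₁ x - X v₂ x
  T-X₃ x = trans (T-indicator v₃ x) (cong₂ (λ a b → X v₃ x + X a x + X v₁ x - X b x) (cong inj₂ ρ-i) (cong inj₁ ρ-i))

  T-X₄ : ∀ x → T (X v₄) x ≡ X v₄ x + X v₃ x + X v₂ x - X v₁ x
  T-X₄ x = trans (T-indicator v₄ x) (cong₂ (λ a b → X v₄ x + X a x + X v₂ x - X b x) (cong inj₂ ρ-j) (cong inj₁ ρ-j))

  S-v₁v₂ : ∀ x y → S (edgeQ v₁ v₂) x y ≡ + 4 * edgeQ v₁ v₂ x y
  S-v₁v₂ = S-edge v₁ v₂ v₁ v₂ (λ x → trans (cong₂ _+_ (T-X₁ x) (T-X₂ x))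
    (solve 4 (λ a b c d → (a :+ b :+ c :- d) :+ (b :+ a :+ d :- c) := con (+ 2) :* (a :+ b)) refl (X v₁ x) (X v₂ x) (X v₃ x) (X v₄ x)))

  S-v₁v₃ : ∀ x y → S (edgeQ v₁ v₃) x y ≡ + 4 * edgeQ v₁ v₃ x y
  S-v₁v₃ = S-edge v₁ v₃ v₁ v₃ (λ x → trans (cong₂ _+_ (T-X₁ x) (T-X₃ x))
    (solve 4 (λ a b c d → (a :+ b :+ c :- d) :+ (c :+ d :+ a :- b) := con (+ 2) :* (a :+ c)) refl (X v₁ x) (X v₂ x) (X v₃ x) (X v₄ x)))

  S-v₁v₄ : ∀ x y → S (edgeQ v₁ v₄) x y ≡ + 4 * edgeQ v₂ v₃ x y
  S-v₁v₄ = S-edge v₁ v₄ v₂ v₃ (λ x → trans (cong₂ _+_ (T-X₁ x) (T-X₄ x))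
    (solve 4 (λ a b c d → (a :+ b :+ c :- d) :+ (d :+ c :+ b :- a) := con (+ 2) :* (b :+ c)) refl (X v₁ x) (X v₂ x) (X v₃ x) (X v₄ x)))

  S-v₂v₃ : ∀ x y → S (edgeQ v₂ v₃) x y ≡ + 4 * edgeQ v₁ v₄ x y
  S-v₂v₃ = S-edge v₂ v₃ v₁ v₄ (λ x → trans (cong₂ _+_ (T-X₂ x) (T-X₃ x))
    (solve 4 (λ a b c d → (b :+ a :+ d :- c) :+ (c :+ d :+ a :- b) := con (+ 2) :* (a :+ d)) refl (X v₁ x) (X v₂ x) (X v₃ x) (X v₄ x)))

  -- The key identity W (tI - Q(G)) Wᵀ = 4 (tI - Q(Gᵗ)) and its converse, at the
  -- level of vertices: the shared part is invariant, the edge terms are permuted.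
  S-charVertex : ∀ t (F F′ e e′ : V → V → ℤ) →
    (∀ x y → F x y ≡ charCycles t x y - edgeQ v₁ v₂ x y - edgeQ v₁ v₃ x y - e x y) →
    (∀ x y → F′ x y ≡ charCycles t x y - edgeQ v₁ v₂ x y - edgeQ v₁ v₃ x y - e′ x y) →
    (∀ x y → S e x y ≡ + 4 * e′ x y) →
    ∀ x y → S F x y ≡ + 4 * F′ x y
  S-charVertex t F F′ e e′ F≡ F′≡ S-e x y = begin
    S F x y
      ≡⟨ S-cong {F} {λ u w → charCycles t u w - edgeQ v₁ v₂ u w - edgeQ v₁ v₃ u w - e u w} x y F≡ ⟩
    S (λ u w → charCycles t u w - edgeQ v₁ v₂ u w - edgeQ v₁ v₃ u w - e u w) x y
      ≡⟨ S-- (λ u w → charCycles t u w - edgeQ v₁ v₂ u w - edgeQ v₁ v₃ u w) e x y ⟩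
    S (λ u w → charCycles t u w - edgeQ v₁ v₂ u w - edgeQ v₁ v₃ u w) x y - S e x y
      ≡⟨ cong (_- S e x y) (S-- (λ u w → charCycles t u w - edgeQ v₁ v₂ u w) (edgeQ v₁ v₃) x y) ⟩
    S (λ u w → charCycles t u w - edgeQ v₁ v₂ u w) x y - S (edgeQ v₁ v₃) x y - S e x y
      ≡⟨ cong (λ s → s - S (edgeQ v₁ v₃) x y - S e x y) (S-- (charCycles t) (edgeQ v₁ v₂) x y) ⟩
    S (charCycles t) x y - S (edgeQ v₁ v₂) x y - S (edgeQ v₁ v₃) x y - S e x y
      ≡⟨ cong₂ _-_ (cong₂ _-_ (cong₂ _-_ (S-invariant (charCycles t) (charCycles-P t) (charCycles-Σ t) x y) (S-v₁v₂ x y)) (S-v₁v₃ x y)) (S-e x y) ⟩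
    + 4 * charCycles t x y - + 4 * edgeQ v₁ v₂ x y - + 4 * edgeQ v₁ v₃ x y - + 4 * e′ x y
      ≡⟨ solve 5 (λ a b c d f → f :* a :- f :* b :- f :* c :- f :* d := f :* (a :- b :- c :- d)) refl
           (charCycles t x y) (edgeQ v₁ v₂ x y) (edgeQ v₁ v₃ x y) (e′ x y) (+ 4) ⟩
    + 4 * (charCycles t x y - edgeQ v₁ v₂ x y - edgeQ v₁ v₃ x y - e′ x y)
      ≡⟨ cong (_*_ (+ 4)) (sym (F′≡ x y)) ⟩
    + 4 * F′ x y ∎

  cospectral : QCospectral q G (partialTranspose G)
  cospectral = cospectral-by-sandwich G (partialTranspose G)
    (λ t → S-charVertex t (charVertex G t) (charVertex (partialTranspose G) t) (edgeQ v₁ v₄) (edgeQ v₂ v₃) (charVertex-G t) (charVertex-Gᵗ t) S-v₁v₄)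
    (λ t → S-charVertex t (charVertex (partialTranspose G) t) (charVertex G t) (edgeQ v₂ v₃) (edgeQ v₁ v₄) (charVertex-Gᵗ t) (charVertex-G t) S-v₂v₃)

  degree-plusEdges : ∀ H u₁ w₁ u₂ w₂ u₃ w₃ →
    (∀ x y → adj H x y ≡ A₀ x y + edgeAdj u₁ w₁ x y + edgeAdj u₂ w₂ x y + edgeAdj u₃ w₃ x y) →
    ∀ x → + degree H x ≡ + 2 + (X u₁ x + X w₁ x) + (X u₂ x + X w₂ x) + (X u₃ x + X w₃ x)
  degree-plusEdges H u₁ w₁ u₂ w₂ u₃ w₃ adj-H x = begin
    + degree H x
      ≡⟨ trans (degree-adj H x) (vsum-cong (adj-H x)) ⟩
    vsum (λ y → A₀ x y + edgeAdj u₁ w₁ x y + edgeAdj u₂ w₂ x y + edgeAdj u₃ w₃ x y)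
      ≡⟨ vsum-+ (λ y → A₀ x y + edgeAdj u₁ w₁ x y + edgeAdj u₂ w₂ x y) (edgeAdj u₃ w₃ x) ⟩
    vsum (λ y → A₀ x y + edgeAdj u₁ w₁ x y + edgeAdj u₂ w₂ x y) + vsum (edgeAdj u₃ w₃ x)
      ≡⟨ cong (_+ vsum (edgeAdj u₃ w₃ x)) (vsum-+ (λ y → A₀ x y + edgeAdj u₁ w₁ x y) (edgeAdj u₂ w₂ x)) ⟩
    vsum (λ y → A₀ x y + edgeAdj u₁ w₁ x y) + vsum (edgeAdj u₂ w₂ x) + vsum (edgeAdj u₃ w₃ x)
      ≡⟨ cong (λ s → s + vsum (edgeAdj u₂ w₂ x) + vsum (edgeAdj u₃ w₃ x)) (vsum-+ (A₀ x) (edgeAdj u₁ w₁ x)) ⟩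
    vsum (A₀ x) + vsum (edgeAdj u₁ w₁ x) + vsum (edgeAdj u₂ w₂ x) + vsum (edgeAdj u₃ w₃ x)
      ≡⟨ cong₂ _+_ (cong₂ _+_ (cong₂ _+_ (cycles-regular x) (vsum-edgeAdj u₁ w₁ x)) (vsum-edgeAdj u₂ w₂ x)) (vsum-edgeAdj u₃ w₃ x) ⟩
    + 2 + (X u₁ x + X w₁ x) + (X u₂ x + X w₂ x) + (X u₃ x + X w₃ x) ∎

  degree-G-v₁ : + degree G v₁ ≡ + 5
  degree-G-v₁ = begin
    + degree G v₁
      ≡⟨ degree-plusEdges G v₁ v₂ v₁ v₃ v₁ v₄ adj-G v₁ ⟩
    + 2 + (X v₁ v₁ + X v₂ v₁) + (X v₁ v₁ + 0ℤ) + (X v₁ v₁ + 0ℤ)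
      ≡⟨ cong₂ (λ a b → + 2 + (a + b) + (a + 0ℤ) + (a + 0ℤ)) (δV-refl v₁) (δV-≢ {x = v₁} {y = v₂} (λ { refl → i≢j refl })) ⟩
    + 5 ∎

  degree-Gᵗ-even : ∀ x → + degree (partialTranspose G) x ≡ + 2 * (1ℤ + X v₁ x + X v₂ x + X v₃ x)
  degree-Gᵗ-even x = trans (degree-plusEdges (partialTranspose G) v₁ v₂ v₁ v₃ v₂ v₃ adj-Gᵗ x)
    (solve 3 (λ a b c → con (+ 2) :+ (a :+ b) :+ (a :+ c) :+ (b :+ c) := con (+ 2) :* (con 1ℤ :+ a :+ b :+ c)) refl
       (X v₁ x) (X v₂ x) (X v₃ x))

  non-isomorphic : ¬ Isomorphic q G (partialTranspose G)
  non-isomorphic iso = 5≢2* (1ℤ + X v₁ u + X v₂ u + X v₃ u) (begin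
    + 5                                     ≡⟨ degree-G-v₁ ⟨
    + degree G v₁                           ≡⟨ cong +_ (degree-isomorphism G (partialTranspose G) iso v₁) ⟩
    + degree (partialTranspose G) u         ≡⟨ degree-Gᵗ-even u ⟩
    + 2 * (1ℤ + X v₁ u + X v₂ u + X v₃ u) ∎)
    where
    u = Inverse.to (proj₁ iso) v₁
    5≢2* : ∀ z → + 5 ≢ + 2 * z
    5≢2* (+ n) 5≡2n = contradiction (cong (ℕ._% 2) (trans (+-injective (trans 5≡2n (sym (pos-* 2 n)))) (ℕP.*-comm 2 n)))
                                    (λ 1≡[n*2]%2 → 1≢0 (trans 1≡[n*2]%2 (m*n%n≡0 n 2)))
      where
      1≢0 : 1 ≢ 0
      1≢0 ()
    5≢2* -[1+ n ] ()

theorem1 : (q : ℕ) → 3 ≤ q → (i j : Fin q) → i ≢ j →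
    G₀ q (inj₁ i) (inj₁ j) ≡ false →
    ¬ Isomorphic q (Gnew q i j) (partialTranspose (Gnew q i j))
    × QCospectral q (Gnew q i j) (partialTranspose (Gnew q i j))
theorem1 (suc (suc (suc p))) (s≤s (s≤s (s≤s z≤n))) i j i≢j nonadjacent =
  non-isomorphic , cospectral
  where open Construction p i j i≢j nonadjacent (Gnew _ i j) (λ _ _ → refl)
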